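{- Let $f(n,k)$ denote the number of Boolean intervals of rank $k$ in the right weak order $W(\mathfrak{S}_n)$. Then $$f(n,k)=\frac{n!}{2^k}\binom{n-k}{k}.$$
   Context: The right weak order $W(\mathfrak{S}_n)$ is the partial order on $\mathfrak{S}_n$ with cover relations $\tau\lessdot\tau s_i$ whenever $\tau(i)<\tau(i+1)$, where $s_i=(i,i+1)$ is a simple transposition. An interval $[v,w]=\{u:v\le u\le w\}$ is a Boolean interval of rank $k$ if it is isomorphic as a poset to the lattice of all subsets of a $k$-element set ordered by inclusion; intervals $[\pi,\pi]$ are Boolean of rank $0$. -}

module Defs where

open import Data.Nat using (ℕ; zero; suc)
open import Data.Fin using (Fin) renaming (_<_ to _<ᶠ_)
open import Data.Fin.Subset using (Subset; _⊆_)
open import Data.Vec using (Vec; []; _∷_; lookup)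
open import Data.List using (List; length)
open import Data.List.Relation.Unary.Unique.Propositional using (Unique)
open import Data.List.Membership.Propositional using (_∈_)
open import Data.Product using (Σ; ∃; _×_; _,_)
open import Data.Empty using (⊥)
open import Relation.Binary.PropositionalEquality using (_≡_)
open import Relation.Binary.Construct.Closure.ReflexiveTransitive using (Star)
open import Function.Bundles using (_⇔_)

-- A permutation of [n] in one-line notation: τ = (τ(1) … τ(n)) as a vector
-- of length n over Fin n in which every value occurs (hence a bijection).
IsPerm : (n : ℕ) → Vec (Fin n) n → Set
IsPerm n τ = ∀ (j : Fin n) → ∃ λ (i : Fin n) → lookup τ i ≡ j

-- τ s_i in one-line notation: swap the entries in positions i and i+1
-- (positions counted from 0 here; out of range means no change, but it is
-- never used out of range because of the ascent condition below).
swapAdj : ∀ {A : Set} {m : ℕ} → Vec A m → ℕ → Vec A m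
swapAdj (x ∷ y ∷ xs) zero = y ∷ x ∷ xs
swapAdj (x ∷ xs) (suc i) = x ∷ swapAdj xs i
swapAdj xs _ = xs

AscentAt : ∀ {n m : ℕ} → Vec (Fin n) m → ℕ → Set
AscentAt (x ∷ y ∷ xs) zero = x <ᶠ y
AscentAt (x ∷ xs) (suc i) = AscentAt xs i
AscentAt _ _ = ⊥

Cover : (n : ℕ) → Vec (Fin n) n → Vec (Fin n) n → Set
Cover n τ σ = IsPerm n τ × (∃ λ (i : ℕ) → AscentAt τ i × σ ≡ swapAdj τ i)

_≤W_ : {n : ℕ} → Vec (Fin n) n → Vec (Fin n) n → Set
_≤W_ {n} = Star (Cover n)

InInterval : (n : ℕ) → Vec (Fin n) n → Vec (Fin n) n → Vec (Fin n) n → Set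
InInterval n v w u = IsPerm n u × (v ≤W u) × (u ≤W w)

IsBooleanInterval : (n k : ℕ) → Vec (Fin n) n → Vec (Fin n) n → Set
IsBooleanInterval n k v w =
  IsPerm n v × IsPerm n w ×
  Σ (Vec (Fin n) n → Subset k) λ φ →
  Σ (Subset k → Vec (Fin n) n) λ ψ →
    (∀ s → InInterval n v w (ψ s)) ×
    (∀ s → φ (ψ s) ≡ s) ×
    (∀ u → InInterval n v w u → ψ (φ u) ≡ u) ×
    (∀ u u' → InInterval n v w u → InInterval n v w u' →
        (u ≤W u') ⇔ (φ u ⊆ φ u'))

NumBooleanIntervals : (n k m : ℕ) → Set
NumBooleanIntervals n k m =
  Σ (List (Vec (Fin n) n × Vec (Fin n) n)) λ L →
    Unique L × length L ≡ m ×
    (∀ v w → ((v , w) ∈ L) ⇔ IsBooleanInterval n k v w)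

-- An interval [v, w] is Boolean of rank k exactly when w arises from v by swapping the entries at k ascents
-- of v in pairwise non-adjacent positions. If so, every u between v and w keeps each order relation shared by
-- v and w, which forces u to be v with some subset of these swaps performed. Conversely, the atoms of a
-- Boolean interval are single adjacent swaps of v at distinct, non-adjacent positions (two adjacent atoms have
-- no common upper cover), and adding the atoms one by one shows that w performs all of them. The admissible
-- position sets are the tilings of n cells by monominoes and k dominoes, counted by C(n-k, k), and for a fixed
-- tiling, sorting each domino increasingly is a 2^k-to-one map from permutations onto the admissible v.

module Submission where

open import Algebra.Bundles using (CommutativeMonoid)
open import Axiom.UniquenessOfIdentityProofs using (module Decidable⇒UIP)
open import Data.Bool as Bool using (Bool; true; false; _∧_; _∨_; not)
import Data.Bool.Properties as BP
open import Data.Empty using (⊥; ⊥-elim)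
open import Data.Fin using (Fin; zero; suc; toℕ; fromℕ<; punchIn; punchOut) renaming (_<_ to _<ᶠ_)
import Data.Fin.Properties as FP
open import Data.Fin.Permutation using (↔⇒≡)
open import Data.Fin.Subset using (Subset; _⊆_; _∈_; _∉_; _∪_; ⁅_⁆) renaming (⊤ to full; ⊥ to none)
import Data.Fin.Subset.Properties as SP
open import Data.List as List using (List; length; allFin)
import Data.List.Properties as LP
open import Data.List.Membership.Propositional using () renaming (_∈_ to _∈ₗ_)
import Data.List.Membership.Propositional.Properties as MP
open import Data.List.Relation.Unary.Unique.Propositional using (Unique)
import Data.List.Relation.Unary.Unique.Propositional.Properties as UP
open import Data.Nat as ℕ using (ℕ; zero; suc; _+_; _*_; _^_; _!; _∸_; _<_; _≤_; z≤n; s≤s; _<ᵇ_)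
import Data.Nat.Properties as NP
open import Data.Nat.Combinatorics using (_C_; nCk+nC[k+1]≡[n+1]C[k+1])
open import Data.Product using (Σ; ∃; _×_; _,_; proj₁; proj₂)
open import Data.Product.Function.Dependent.Propositional using (Σ-↔)
open import Data.Product.Function.NonDependent.Propositional using (_×-↔_)
open import Data.Product.Properties using (,-injectiveˡ; ,-injectiveʳ)
open import Data.Sum using (_⊎_; inj₁; inj₂)
open import Data.Sum.Function.Propositional using (_⊎-↔_)
open import Data.Unit using (⊤; tt)
open import Data.Vec using (Vec; []; _∷_; lookup; tabulate; map; here; there)
import Data.Vec.Properties as VP
open import Function using (_∘_; id)
open import Function.Bundles using (_⇔_; mk⇔; Equivalence; Inverse; _↔_; mk↔ₛ′)
import Function.Properties.Equivalence as Eqv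
open import Function.Properties.Inverse using (↔-refl; ↔-sym; ↔-trans)
open import Relation.Binary using (tri<; tri≈; tri>)
open import Relation.Binary.Construct.Closure.ReflexiveTransitive using (Star; ε; _◅_; _◅◅_)
open import Relation.Binary.PropositionalEquality
open import Relation.Nullary using (Dec; yes; no; ¬_; does; contradiction)
open import Relation.Nullary.Decidable using (dec-true; dec-false; does-⇔; _×-dec_)

open import Defs

open import Algebra.Properties.CommutativeSemigroup (CommutativeMonoid.commutativeSemigroup BP.∨-commutativeMonoid)
  using () renaming (x∙yz≈y∙xz to ∨-swap)

module Bool-UIP = Decidable⇒UIP Bool._≟_

private variable
  n m k : ℕ

bool-clash : {a : Bool} → a ≡ true → a ≡ false → ⊥
bool-clash refl ()

∨≡true⁻ : {a b : Bool} → a ∨ b ≡ true → a ≡ true ⊎ b ≡ true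
∨≡true⁻ {true} _ = inj₁ refl
∨≡true⁻ {false} e = inj₂ e

∨≡trueʳ : (a : Bool) {b : Bool} → b ≡ true → a ∨ b ≡ true
∨≡trueʳ true _ = refl
∨≡trueʳ false e = e

∨≡false⁻ : {a b : Bool} → a ∨ b ≡ false → a ≡ false × b ≡ false
∨≡false⁻ {false} {false} _ = refl , refl

∧≡true⁻ : {a b : Bool} → a ∧ b ≡ true → a ≡ true × b ≡ true
∧≡true⁻ {true} {true} _ = refl , refl

not≡true⁻ : {a : Bool} → not a ≡ true → a ≡ false
not≡true⁻ {false} _ = refl

does≡true⇒ : {A : Set} (a? : Dec A) → does a? ≡ true → A
does≡true⇒ (yes a) _ = a

-- Entries of vectors and their relative order

_==_ : Fin n → Fin n → Bool
a == b = does (a FP.≟ b)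

==-refl : (a : Fin n) → (a == a) ≡ true
==-refl a = dec-true (a FP.≟ a) refl

==-false : {a b : Fin n} → a ≢ b → (a == b) ≡ false
==-false = dec-false (_ FP.≟ _)

occurs : Fin n → Vec (Fin n) m → Bool
occurs a [] = false
occurs a (x ∷ r) = (x == a) ∨ occurs a r

before : Vec (Fin n) m → Fin n → Fin n → Bool
before [] a b = false
before (x ∷ r) a b = ((x == a) ∧ occurs b r) ∨ before r a b

occurs-head : (x : Fin n) (r : Vec (Fin n) m) → occurs x (x ∷ r) ≡ true
occurs-head x r = cong (_∨ occurs x r) (==-refl x)

data Distinct {n : ℕ} : ∀ {m} → Vec (Fin n) m → Set where
  [] : Distinct []
  _∷_ : ∀ {m x} {r : Vec (Fin n) m} → occurs x r ≡ false → Distinct r → Distinct (x ∷ r)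

-- ℕ-indexed variant of Data.Vec's _[_]=_, matching the ℕ positions of swapAdj and AscentAt.
data At {A : Set} : ∀ {m} → Vec A m → ℕ → A → Set where
  here : ∀ {m x} {r : Vec A m} → At (x ∷ r) zero x
  there : ∀ {m x y i} {r : Vec A m} → At r i y → At (x ∷ r) (suc i) y

PairAt : {A : Set} → Vec A m → ℕ → A → A → Set
PairAt u i a b = At u i a × At u (suc i) b

At-functional : {A : Set} {u : Vec A m} {i : ℕ} {a b : A} → At u i a → At u i b → a ≡ b
At-functional here here = refl
At-functional (there p) (there q) = At-functional p q

At⇒occurs : {u : Vec (Fin n) m} {i : ℕ} {a : Fin n} → At u i a → occurs a u ≡ true
At⇒occurs {u = x ∷ r} here = occurs-head x r
At⇒occurs (there p) = ∨≡trueʳ _ (At⇒occurs p)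

occurs⇒At : (u : Vec (Fin n) m) {a : Fin n} → occurs a u ≡ true → ∃ λ i → At u i a
occurs⇒At (x ∷ r) {a} e with x FP.≟ a
... | yes refl = zero , here
... | no _ = let (i , p) = occurs⇒At r e in suc i , there p

At-injective : {u : Vec (Fin n) m} {i j : ℕ} {a : Fin n} → Distinct u → At u i a → At u j a → i ≡ j
At-injective d here here = refl
At-injective (a∉r ∷ d) here (there q) = ⊥-elim (bool-clash (At⇒occurs q) a∉r)
At-injective (a∉r ∷ d) (there p) here = ⊥-elim (bool-clash (At⇒occurs p) a∉r)
At-injective (_ ∷ d) (there p) (there q) = cong suc (At-injective d p q)

At⇒before : {u : Vec (Fin n) m} {i j : ℕ} {a b : Fin n} → At u i a → At u j b → i < j → before u a b ≡ true
At⇒before {a = a} here (there q) _ rewrite ==-refl a | At⇒occurs q = refl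
At⇒before (there p) (there q) (s≤s i<j) = ∨≡trueʳ _ (At⇒before p q i<j)

before⇒occurs₁ : (u : Vec (Fin n) m) {a b : Fin n} → before u a b ≡ true → occurs a u ≡ true
before⇒occurs₁ (x ∷ r) {a} {b} e with ∨≡true⁻ {(x == a) ∧ occurs b r} e
... | inj₁ e₁ rewrite proj₁ (∧≡true⁻ {x == a} e₁) = refl
... | inj₂ e₂ = ∨≡trueʳ _ (before⇒occurs₁ r e₂)

before⇒occurs₂ : (u : Vec (Fin n) m) {a b : Fin n} → before u a b ≡ true → occurs b u ≡ true
before⇒occurs₂ (x ∷ r) {a} {b} e with ∨≡true⁻ {(x == a) ∧ occurs b r} e
... | inj₁ e₁ = ∨≡trueʳ _ (proj₂ (∧≡true⁻ {x == a} e₁))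
... | inj₂ e₂ = ∨≡trueʳ _ (before⇒occurs₂ r e₂)

before-irrefl : {u : Vec (Fin n) m} {a : Fin n} → Distinct u → before u a a ≡ false
before-irrefl [] = refl
before-irrefl {u = x ∷ r} {a} (x∉r ∷ d) with x FP.≟ a
... | yes refl rewrite x∉r = before-irrefl d
... | no _ = before-irrefl d

before-asym : {u : Vec (Fin n) m} {a b : Fin n} → Distinct u → before u a b ≡ true → before u b a ≡ false
before-asym {u = x ∷ r} {a} {b} (x∉r ∷ d) e with x FP.≟ a | x FP.≟ b
... | yes refl | yes refl with ∨≡true⁻ {occurs x r} e
...   | inj₁ x∈r = ⊥-elim (bool-clash x∈r x∉r)
...   | inj₂ x≺x = ⊥-elim (bool-clash x≺x (before-irrefl d))
before-asym {u = x ∷ r} {a} {b} (x∉r ∷ d) e | yes refl | no _ with before r b x in b≺x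
... | true = ⊥-elim (bool-clash (before⇒occurs₂ r b≺x) x∉r)
... | false = refl
before-asym {u = x ∷ r} {a} {b} (x∉r ∷ d) e | no _ | yes refl = ⊥-elim (bool-clash (before⇒occurs₂ r e) x∉r)
before-asym {u = x ∷ r} {a} {b} (x∉r ∷ d) e | no _ | no _ = before-asym d e

before-total : (u : Vec (Fin n) m) {a b : Fin n} → occurs a u ≡ true → occurs b u ≡ true → a ≢ b →
               before u a b ≡ true ⊎ before u b a ≡ true
before-total (x ∷ r) {a} {b} a∈u b∈u a≢b with x FP.≟ a | x FP.≟ b
... | yes refl | yes refl = ⊥-elim (a≢b refl)
... | yes refl | no _ = inj₁ (cong (_∨ before r x b) b∈u)
... | no _ | yes refl = inj₂ (cong (_∨ before r x a) a∈u)
... | no _ | no _ = before-total r a∈u b∈u a≢b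

¬occurs-head⇒≢ : {x y : Fin n} {r : Vec (Fin n) m} → occurs x (y ∷ r) ≡ false → x ≢ y
¬occurs-head⇒≢ {x = x} {r = r} e refl = bool-clash (occurs-head x r) e

¬occurs-∷⁻ : {x y : Fin n} {r : Vec (Fin n) m} → occurs x (y ∷ r) ≡ false → x ≢ y × occurs x r ≡ false
¬occurs-∷⁻ {x = x} {y} {r} x∉y∷r = ¬occurs-head⇒≢ {r = r} x∉y∷r , proj₂ (∨≡false⁻ {y == x} x∉y∷r)

before-∷ : (x : Fin n) (r : Vec (Fin n) m) {a b : Fin n} → before r a b ≡ true → before (x ∷ r) a b ≡ true
before-∷ x r {a} {b} = ∨≡trueʳ ((x == a) ∧ occurs b r)

before-∷⁻ : (x : Fin n) (r : Vec (Fin n) m) {a b : Fin n} → before (x ∷ r) a b ≡ true → x ≢ a → before r a b ≡ true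
before-∷⁻ x r {a} {b} e x≢a = subst (λ t → (t ∧ occurs b r) ∨ before r a b ≡ true) (==-false x≢a) e

before-head : (x : Fin n) (r : Vec (Fin n) m) {b : Fin n} → occurs b r ≡ true → before (x ∷ r) x b ≡ true
before-head x r b∈r rewrite ==-refl x | b∈r = refl

occurs-∷⁻ : (x : Fin n) (r : Vec (Fin n) m) {a : Fin n} → occurs a (x ∷ r) ≡ true → x ≢ a → occurs a r ≡ true
occurs-∷⁻ x r {a} e x≢a = subst (λ t → t ∨ occurs a r ≡ true) (==-false x≢a) e

¬occurs-occurs⇒≢ : {x a : Fin n} {r : Vec (Fin n) m} → occurs x r ≡ false → occurs a r ≡ true → x ≢ a
¬occurs-occurs⇒≢ x∉r a∈r refl = bool-clash a∈r x∉r

¬before-head : {h a : Fin n} {r : Vec (Fin n) m} → Distinct (h ∷ r) → before (h ∷ r) a h ≢ true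
¬before-head {h = h} {a} {r} d@(h∉r ∷ _) a≺h with a FP.≟ h
... | yes refl = bool-clash a≺h (before-irrefl d)
... | no a≢h = bool-clash (before⇒occurs₂ r (before-∷⁻ h r a≺h (a≢h ∘ sym))) h∉r

before-second⇒first : {c₁ c₂ a : Fin n} {r : Vec (Fin n) m} → Distinct (c₁ ∷ c₂ ∷ r) →
                      before (c₁ ∷ c₂ ∷ r) a c₂ ≡ true → a ≡ c₁
before-second⇒first {c₁ = c₁} {c₂} {a} {r} (_ ∷ d) a≺c₂ with a FP.≟ c₁
... | yes a≡c₁ = a≡c₁
... | no a≢c₁ = ⊥-elim (¬before-head d (before-∷⁻ c₁ (c₂ ∷ r) a≺c₂ (a≢c₁ ∘ sym)))

-- Adjacent transpositions

occurs-swapAdj : (u : Vec (Fin n) m) (i : ℕ) (a : Fin n) → occurs a (swapAdj u i) ≡ occurs a u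
occurs-swapAdj [] i a = refl
occurs-swapAdj (x ∷ []) zero a = refl
occurs-swapAdj (x ∷ []) (suc i) a = refl
occurs-swapAdj (x ∷ y ∷ r) zero a = ∨-swap (y == a) (x == a) _
occurs-swapAdj (x ∷ y ∷ r) (suc i) a = cong ((x == a) ∨_) (occurs-swapAdj (y ∷ r) i a)

Distinct-swapAdj : {u : Vec (Fin n) m} (i : ℕ) → Distinct u → Distinct (swapAdj u i)
Distinct-swapAdj {u = []} i d = d
Distinct-swapAdj {u = x ∷ []} zero d = d
Distinct-swapAdj {u = x ∷ []} (suc i) d = d
Distinct-swapAdj {u = x ∷ y ∷ r} zero (x∉y∷r ∷ y∉r ∷ d) =
  let (x≢y , x∉r) = ¬occurs-∷⁻ {y = y} {r} x∉y∷r in trans (cong (_∨ occurs y r) (==-false x≢y)) y∉r ∷ x∉r ∷ d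
Distinct-swapAdj {u = x ∷ y ∷ r} (suc i) (x∉r ∷ d) =
  trans (occurs-swapAdj (y ∷ r) i x) x∉r ∷ Distinct-swapAdj i d

ascent⇒PairAt : (u : Vec (Fin n) m) (i : ℕ) → AscentAt u i → ∃ λ x → ∃ λ y → PairAt u i x y × x <ᶠ y
ascent⇒PairAt (x ∷ y ∷ r) zero x<y = x , y , (here , there here) , x<y
ascent⇒PairAt (x ∷ y ∷ r) (suc i) a =
  let (x′ , y′ , (p , q) , x′<y′) = ascent⇒PairAt (y ∷ r) i a in x′ , y′ , (there p , there q) , x′<y′

swapAdj-PairAt : {A : Set} {u : Vec A m} {i : ℕ} {x y : A} → PairAt u i x y → PairAt (swapAdj u i) i y x
swapAdj-PairAt (here , there here) = here , there here
swapAdj-PairAt {u = x ∷ y ∷ r} (there p , there q) =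
  let (p′ , q′) = swapAdj-PairAt {u = y ∷ r} (p , q) in there p′ , there q′

swapAdj-At-elsewhere : {A : Set} {u : Vec A m} {i j : ℕ} {x y z : A} → PairAt u i x y → At u j z →
                       j ≢ i → j ≢ suc i → At (swapAdj u i) j z
swapAdj-At-elsewhere (here , there here) here j≢i _ = ⊥-elim (j≢i refl)
swapAdj-At-elsewhere (here , there here) (there here) _ j≢1+i = ⊥-elim (j≢1+i refl)
swapAdj-At-elsewhere (here , there here) (there (there q)) _ _ = there (there q)
swapAdj-At-elsewhere {u = x ∷ y ∷ r} (there p , there q) here _ _ = here
swapAdj-At-elsewhere {u = x ∷ y ∷ r} (there p , there q) (there s) j≢i j≢1+i =
  there (swapAdj-At-elsewhere {u = y ∷ r} (p , q) s (j≢i ∘ cong suc) (j≢1+i ∘ cong suc))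

before-swapAdj-elsewhere : {u : Vec (Fin n) m} {i : ℕ} {x y a b : Fin n} → Distinct u → PairAt u i x y →
                           ¬ (a ≡ x × b ≡ y) → ¬ (a ≡ y × b ≡ x) → before (swapAdj u i) a b ≡ before u a b
before-swapAdj-elsewhere {u = x ∷ y ∷ r} {a = a} {b} (x∉y∷r ∷ _) (here , there here) ab≢xy ab≢yx
  with x FP.≟ a | y FP.≟ a
... | yes refl | yes refl = ⊥-elim (¬occurs-head⇒≢ {r = r} x∉y∷r refl)
... | yes refl | no _ with y FP.≟ b
...   | yes refl = ⊥-elim (ab≢xy (refl , refl))
...   | no _ = refl
before-swapAdj-elsewhere {u = x ∷ y ∷ r} {a = a} {b} _ (here , there here) ab≢xy ab≢yx
  | no _ | yes refl with x FP.≟ b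
...   | yes refl = ⊥-elim (ab≢yx (refl , refl))
...   | no _ = refl
before-swapAdj-elsewhere {u = x ∷ y ∷ r} _ (here , there here) _ _ | no _ | no _ = refl
before-swapAdj-elsewhere {u = x ∷ y ∷ r} {i = suc i} {a = a} {b} (_ ∷ d) (there p , there q) ab≢xy ab≢yx =
  cong₂ (λ e f → ((x == a) ∧ e) ∨ f) (occurs-swapAdj (y ∷ r) i b)
        (before-swapAdj-elsewhere {u = y ∷ r} d (p , q) ab≢xy ab≢yx)

PairAt⇒before : {u : Vec (Fin n) m} {i : ℕ} {x y : Fin n} → PairAt u i x y → before u x y ≡ true
PairAt⇒before {i = i} (p , q) = At⇒before p q (NP.n<1+n i)

before-swapAdj-PairAt : {u : Vec (Fin n) m} {i : ℕ} {x y : Fin n} → PairAt u i x y → before (swapAdj u i) y x ≡ true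
before-swapAdj-PairAt pq = PairAt⇒before (swapAdj-PairAt pq)

swapAdj-keeps-inversion : {u : Vec (Fin n) m} {i : ℕ} {a b : Fin n} → Distinct u → AscentAt u i → a <ᶠ b →
                          before u b a ≡ true → before (swapAdj u i) b a ≡ true
swapAdj-keeps-inversion {u = u} {i} {a} {b} d ascent a<b b≺a
  with ascent⇒PairAt u i ascent
... | x , y , pq , x<y with b FP.≟ x ×-dec a FP.≟ y | b FP.≟ y ×-dec a FP.≟ x
...   | yes (refl , refl) | _ = contradiction x<y (FP.<-asym a<b)
...   | no _ | yes (refl , refl) = ⊥-elim (bool-clash b≺a (before-asym d (PairAt⇒before pq)))
...   | no ba≢xy | no ba≢yx = trans (before-swapAdj-elsewhere d pq ba≢xy ba≢yx) b≺a

swapAdj-reverses-only-pair : {u : Vec (Fin n) m} {i : ℕ} {x y a b : Fin n} → Distinct u → PairAt u i x y →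
                                 before u a b ≡ true → before (swapAdj u i) b a ≡ true → a ≡ x × b ≡ y
swapAdj-reverses-only-pair {x = x} {y} {a} {b} d pq a≺b b≺a′
  with a FP.≟ x ×-dec b FP.≟ y | a FP.≟ y ×-dec b FP.≟ x
... | yes ab≡xy | _ = ab≡xy
... | no _ | yes (refl , refl) = ⊥-elim (bool-clash a≺b (before-asym d (PairAt⇒before pq)))
... | no ab≢xy | no ab≢yx =
  ⊥-elim (bool-clash b≺a′ (trans (before-swapAdj-elsewhere d pq (λ (p , q) → ab≢yx (q , p)) (λ (p , q) → ab≢xy (q , p)))
                                 (before-asym d a≺b)))


-- Permutations and the weak order

lookup-At : {A : Set} (u : Vec A m) (i : Fin m) → At u (toℕ i) (lookup u i)
lookup-At (x ∷ u) zero = here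
lookup-At (x ∷ u) (suc i) = there (lookup-At u i)

At⇒lookup : {A : Set} {u : Vec A m} {j : ℕ} {a : A} → At u j a → ∃ λ (i : Fin m) → lookup u i ≡ a
At⇒lookup here = zero , refl
At⇒lookup (there p) = let (i , e) = At⇒lookup p in suc i , e

IsPerm⇒occurs : {u : Vec (Fin n) n} → IsPerm n u → ∀ a → occurs a u ≡ true
IsPerm⇒occurs {u = u} p a with p a
... | i , refl = At⇒occurs (lookup-At u i)

occurs⇒IsPerm : {u : Vec (Fin n) n} → (∀ a → occurs a u ≡ true) → IsPerm n u
occurs⇒IsPerm {u = u} h a = At⇒lookup (proj₂ (occurs⇒At u (h a)))

injective⇒surjective : (f : Fin n → Fin n) → (∀ i j → f i ≡ f j → i ≡ j) → ∀ j → ∃ λ i → f i ≡ j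
injective⇒surjective {suc n} f f-injective j with FP.any? (λ i → f i FP.≟ j)
... | yes hit = hit
... | no miss = contradiction (FP.injective⇒≤ {f = f′} f′-injective) NP.1+n≰n
  where
  f′ : Fin (suc n) → Fin n
  f′ i = punchOut (λ j≡fi → miss (i , sym j≡fi))
  f′-injective : ∀ {x y} → f′ x ≡ f′ y → x ≡ y
  f′-injective {x} {y} e =
    f-injective x y (FP.punchOut-injective (λ j≡fx → miss (x , sym j≡fx)) (λ j≡fy → miss (y , sym j≡fy)) e)

surjective⇒injective : (f : Fin n → Fin n) → (∀ j → ∃ λ i → f i ≡ j) → ∀ i j → f i ≡ f j → i ≡ j
surjective⇒injective {n} f f-surjective i j fi≡fj
  with injective⇒surjective section section-injective i | injective⇒surjective section section-injective j
  where
  section : Fin n → Fin n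
  section = proj₁ ∘ f-surjective
  section-injective : ∀ x y → section x ≡ section y → x ≡ y
  section-injective x y e = trans (sym (proj₂ (f-surjective x))) (trans (cong f e) (proj₂ (f-surjective y)))
... | a , refl | b , refl =
  cong (proj₁ ∘ f-surjective) (trans (sym (proj₂ (f-surjective a))) (trans fi≡fj (proj₂ (f-surjective b))))

Distinct⇒lookup-injective : {u : Vec (Fin n) m} → Distinct u → ∀ i j → lookup u i ≡ lookup u j → i ≡ j
Distinct⇒lookup-injective {u = u} d i j e =
  FP.toℕ-injective (At-injective d (lookup-At u i) (subst (At u (toℕ j)) (sym e) (lookup-At u j)))

lookup-injective⇒Distinct : (u : Vec (Fin n) m) → (∀ i j → lookup u i ≡ lookup u j → i ≡ j) → Distinct u
lookup-injective⇒Distinct [] _ = []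
lookup-injective⇒Distinct (x ∷ r) inj with occurs x r in x∈r
... | true = let (i , e) = At⇒lookup (proj₂ (occurs⇒At r x∈r)) in contradiction (inj (suc i) zero e) λ ()
... | false = x∈r ∷ lookup-injective⇒Distinct r (λ i j e → FP.suc-injective (inj (suc i) (suc j) e))

IsPerm⇒Distinct : {u : Vec (Fin n) n} → IsPerm n u → Distinct u
IsPerm⇒Distinct {u = u} p = lookup-injective⇒Distinct u (surjective⇒injective (lookup u) p)

Distinct⇒IsPerm : {u : Vec (Fin n) n} → Distinct u → IsPerm n u
Distinct⇒IsPerm {u = u} d = injective⇒surjective (lookup u) (Distinct⇒lookup-injective d)

IsPerm-swapAdj : {u : Vec (Fin n) n} (i : ℕ) → IsPerm n u → IsPerm n (swapAdj u i)
IsPerm-swapAdj {u = u} i p = occurs⇒IsPerm {u = swapAdj u i} (λ a → trans (occurs-swapAdj u i a) (IsPerm⇒occurs {u = u} p a))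

-- ≤W without the permutation side condition, so that it also relates tails of permutations.
_⋖_ : Vec (Fin n) m → Vec (Fin n) m → Set
u ⋖ u′ = ∃ λ i → AscentAt u i × u′ ≡ swapAdj u i

_≼_ : Vec (Fin n) m → Vec (Fin n) m → Set
_≼_ = Star _⋖_

≤W⇒≼ : {u u′ : Vec (Fin n) n} → u ≤W u′ → u ≼ u′
≤W⇒≼ ε = ε
≤W⇒≼ ((_ , c) ◅ s) = c ◅ ≤W⇒≼ s

≼⇒≤W : {u u′ : Vec (Fin n) n} → IsPerm n u → u ≼ u′ → u ≤W u′
≼⇒≤W p ε = ε
≼⇒≤W {u = u} p ((i , a , refl) ◅ s) = (p , i , a , refl) ◅ ≼⇒≤W (IsPerm-swapAdj {u = u} i p) s

≤W-IsPermˡ : {u u′ : Vec (Fin n) n} → u ≤W u′ → IsPerm n u′ → IsPerm n u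
≤W-IsPermˡ ε p = p
≤W-IsPermˡ ((p , _) ◅ _) _ = p

⋖-∷ : {r r′ : Vec (Fin n) m} (x : Fin n) → r ⋖ r′ → (x ∷ r) ⋖ (x ∷ r′)
⋖-∷ {r = y ∷ r} x (i , a , refl) = suc i , a , refl

≼-∷ : {r r′ : Vec (Fin n) m} (x : Fin n) → r ≼ r′ → (x ∷ r) ≼ (x ∷ r′)
≼-∷ x ε = ε
≼-∷ x (c ◅ s) = ⋖-∷ x c ◅ ≼-∷ x s

≼-occurs : {u u′ : Vec (Fin n) m} → u ≼ u′ → ∀ a → occurs a u′ ≡ occurs a u
≼-occurs ε a = refl
≼-occurs {u = u} ((i , _ , refl) ◅ s) a = trans (≼-occurs s a) (occurs-swapAdj u i a)

≼-Distinct : {u u′ : Vec (Fin n) m} → u ≼ u′ → Distinct u → Distinct u′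
≼-Distinct ε d = d
≼-Distinct ((i , _ , refl) ◅ s) d = ≼-Distinct s (Distinct-swapAdj i d)

≼-keeps-inversion : {u u′ : Vec (Fin n) m} {a b : Fin n} → Distinct u → u ≼ u′ → a <ᶠ b →
                    before u b a ≡ true → before u′ b a ≡ true
≼-keeps-inversion d ε a<b b≺a = b≺a
≼-keeps-inversion d ((i , ascent , refl) ◅ s) a<b b≺a =
  ≼-keeps-inversion (Distinct-swapAdj i d) s a<b (swapAdj-keeps-inversion d ascent a<b b≺a)

swapAdj-ascent-≢ : {u : Vec (Fin n) m} {i : ℕ} → Distinct u → AscentAt u i → swapAdj u i ≢ u
swapAdj-ascent-≢ {u = u} {i} d ascent e with ascent⇒PairAt u i ascent
... | x , y , pq , _ =
  bool-clash (subst (λ w → before w y x ≡ true) e (before-swapAdj-PairAt pq)) (before-asym d (PairAt⇒before pq))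

-- Tilings by monominoes and dominoes

data Tiling : ℕ → Set where
  empty : Tiling 0
  mono : Tiling n → Tiling (suc n)
  domino : Tiling n → Tiling (suc (suc n))

dominoes : Tiling n → ℕ
dominoes empty = 0
dominoes (mono p) = dominoes p
dominoes (domino p) = suc (dominoes p)

swapDominoes : {A : Set} (p : Tiling n) → Subset (dominoes p) → Vec A n → Vec A n
swapDominoes empty [] [] = []
swapDominoes (mono p) s (x ∷ v) = x ∷ swapDominoes p s v
swapDominoes (domino p) (true ∷ s) (x ∷ y ∷ v) = y ∷ x ∷ swapDominoes p s v
swapDominoes (domino p) (false ∷ s) (x ∷ y ∷ v) = x ∷ y ∷ swapDominoes p s v

swapAll : {A : Set} (p : Tiling n) → Vec A n → Vec A n
swapAll p = swapDominoes p full

AscentsAt : Tiling n → Vec (Fin m) n → Set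
AscentsAt empty [] = ⊤
AscentsAt (mono p) (x ∷ v) = AscentsAt p v
AscentsAt (domino p) (x ∷ y ∷ v) = x <ᶠ y × AscentsAt p v

_<ᵇᶠ_ : Fin n → Fin n → Bool
x <ᵇᶠ y = does (x FP.<? y)

descentSet : (p : Tiling n) → Vec (Fin m) n → Subset (dominoes p)
descentSet empty [] = []
descentSet (mono p) (x ∷ v) = descentSet p v
descentSet (domino p) (x ∷ y ∷ v) = (y <ᵇᶠ x) ∷ descentSet p v

descentSet-swapDominoes : (p : Tiling n) (s : Subset (dominoes p)) (v : Vec (Fin m) n) →
                          AscentsAt p v → descentSet p (swapDominoes p s v) ≡ s
descentSet-swapDominoes empty [] [] _ = refl
descentSet-swapDominoes (mono p) s (x ∷ v) a = descentSet-swapDominoes p s v a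
descentSet-swapDominoes (domino p) (true ∷ s) (x ∷ y ∷ v) (x<y , a) =
  cong₂ _∷_ (dec-true (x FP.<? y) x<y) (descentSet-swapDominoes p s v a)
descentSet-swapDominoes (domino p) (false ∷ s) (x ∷ y ∷ v) (x<y , a) =
  cong₂ _∷_ (dec-false (y FP.<? x) (FP.<-asym x<y)) (descentSet-swapDominoes p s v a)

swapDominoes-none : {A : Set} (p : Tiling n) (v : Vec A n) → swapDominoes p none v ≡ v
swapDominoes-none empty [] = refl
swapDominoes-none (mono p) (x ∷ v) = cong (x ∷_) (swapDominoes-none p v)
swapDominoes-none (domino p) (x ∷ y ∷ v) = cong (λ r → x ∷ y ∷ r) (swapDominoes-none p v)

occurs-swapDominoes : (p : Tiling n) (s : Subset (dominoes p)) (v : Vec (Fin m) n) (a : Fin m) →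
                      occurs a (swapDominoes p s v) ≡ occurs a v
occurs-swapDominoes empty [] [] a = refl
occurs-swapDominoes (mono p) s (x ∷ v) a = cong ((x == a) ∨_) (occurs-swapDominoes p s v a)
occurs-swapDominoes (domino p) (true ∷ s) (x ∷ y ∷ v) a =
  trans (cong (λ e → (y == a) ∨ ((x == a) ∨ e)) (occurs-swapDominoes p s v a)) (∨-swap (y == a) (x == a) _)
occurs-swapDominoes (domino p) (false ∷ s) (x ∷ y ∷ v) a =
  cong (λ e → (x == a) ∨ ((y == a) ∨ e)) (occurs-swapDominoes p s v a)

IsPerm-swapDominoes : (p : Tiling n) (s : Subset (dominoes p)) {v : Vec (Fin n) n} →
                      IsPerm n v → IsPerm n (swapDominoes p s v)
IsPerm-swapDominoes p s {v} pv =
  occurs⇒IsPerm {u = swapDominoes p s v} (λ a → trans (occurs-swapDominoes p s v a) (IsPerm⇒occurs {u = v} pv a))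

swapDominoes-monotone : (p : Tiling n) {s s′ : Subset (dominoes p)} (v : Vec (Fin m) n) → AscentsAt p v →
                    s ⊆ s′ → swapDominoes p s v ≼ swapDominoes p s′ v
swapDominoes-monotone empty {[]} {[]} [] _ _ = ε
swapDominoes-monotone (mono p) (x ∷ v) a s⊆s′ = ≼-∷ x (swapDominoes-monotone p v a s⊆s′)
swapDominoes-monotone (domino p) {true ∷ s} {true ∷ s′} (x ∷ y ∷ v) (_ , a) s⊆s′ =
  ≼-∷ y (≼-∷ x (swapDominoes-monotone p v a (SP.drop-∷-⊆ s⊆s′)))
swapDominoes-monotone (domino p) {false ∷ s} {false ∷ s′} (x ∷ y ∷ v) (_ , a) s⊆s′ =
  ≼-∷ x (≼-∷ y (swapDominoes-monotone p v a (SP.drop-∷-⊆ s⊆s′)))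
swapDominoes-monotone (domino p) {false ∷ s} {true ∷ s′} (x ∷ y ∷ v) (x<y , a) s⊆s′ =
  (zero , x<y , refl) ◅ ≼-∷ y (≼-∷ x (swapDominoes-monotone p v a (SP.drop-∷-⊆ s⊆s′)))
swapDominoes-monotone (domino p) {true ∷ s} {false ∷ s′} (x ∷ y ∷ v) _ s⊆s′ with s⊆s′ here
... | ()

Distinct-swapDominoes : (p : Tiling n) (s : Subset (dominoes p)) {v : Vec (Fin m) n} →
                        Distinct v → Distinct (swapDominoes p s v)
Distinct-swapDominoes empty [] [] = []
Distinct-swapDominoes (mono p) s {x ∷ v} (x∉v ∷ d) =
  trans (occurs-swapDominoes p s v x) x∉v ∷ Distinct-swapDominoes p s d
Distinct-swapDominoes (domino p) (b ∷ s) {x ∷ y ∷ v} (x∉y∷v ∷ y∉v ∷ d) = swapped-or-not b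
  where
  unswapped : Distinct (x ∷ y ∷ swapDominoes p s v)
  unswapped = trans (cong ((y == x) ∨_) (occurs-swapDominoes p s v x)) x∉y∷v
            ∷ trans (occurs-swapDominoes p s v y) y∉v ∷ Distinct-swapDominoes p s d
  swapped-or-not : ∀ b → Distinct (swapDominoes (domino p) (b ∷ s) (x ∷ y ∷ v))
  swapped-or-not true = Distinct-swapAdj 0 unswapped
  swapped-or-not false = unswapped

-- The interval spanned by a tiling is Boolean

SameEntries : Vec (Fin n) m → Vec (Fin n) m → Set
SameEntries u v = ∀ a → occurs a u ≡ occurs a v

SameEntries-∷⁻ : {x : Fin n} {u v : Vec (Fin n) m} → occurs x u ≡ false → occurs x v ≡ false →
                 SameEntries (x ∷ u) (x ∷ v) → SameEntries u v
SameEntries-∷⁻ {x = x} x∉u x∉v same a with x FP.≟ a | same a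
... | yes refl | _ = trans x∉u (sym x∉v)
... | no _ | same-a = same-a

Between : Vec (Fin n) m → Vec (Fin n) m → Vec (Fin n) m → Set
Between v w u = ∀ a b → before v a b ≡ true → before w a b ≡ true → before u a b ≡ true

-- Inversions only accumulate along ≼, so u keeps the inversions of v and the non-inversions of w.
≼-between : {v u w : Vec (Fin n) m} → Distinct v → v ≼ u → u ≼ w → Between v w u
≼-between {v = v} {u} {w} dv v≼u u≼w a b a≺b-v a≺b-w with FP.<-cmp a b
... | tri≈ _ refl _ = ⊥-elim (bool-clash a≺b-v (before-irrefl dv))
... | tri> _ _ b<a = ≼-keeps-inversion dv v≼u b<a a≺b-v
... | tri< a<b _ _
  with before-total u (trans (≼-occurs v≼u a) (before⇒occurs₁ v a≺b-v))
                      (trans (≼-occurs v≼u b) (before⇒occurs₂ v a≺b-v)) (FP.<⇒≢ a<b)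
...   | inj₁ a≺b-u = a≺b-u
...   | inj₂ b≺a-u =
  ⊥-elim (bool-clash (≼-keeps-inversion du u≼w a<b b≺a-u) (before-asym (≼-Distinct u≼w du) a≺b-w))
  where
  du : Distinct u
  du = ≼-Distinct v≼u dv

Between-∷⁻ : {a b c : Fin n} {v w u : Vec (Fin n) m} → occurs c v ≡ false →
             Between (a ∷ v) (b ∷ w) (c ∷ u) → Between v w u
Between-∷⁻ {a = a} {b} {c} {v} {w} {u} c∉v btw x y x≺y-v x≺y-w =
  before-∷⁻ c u (btw x y (before-∷ a v x≺y-v) (before-∷ b w x≺y-w))
            (¬occurs-occurs⇒≢ {r = v} c∉v (before⇒occurs₁ v x≺y-v))

Between-∷∷⁻ : {a₁ a₂ b₁ b₂ c₁ c₂ : Fin n} {v w u : Vec (Fin n) m} → occurs c₁ v ≡ false → occurs c₂ v ≡ false →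
              Between (a₁ ∷ a₂ ∷ v) (b₁ ∷ b₂ ∷ w) (c₁ ∷ c₂ ∷ u) → Between v w u
Between-∷∷⁻ {a₁ = a₁} {a₂} {b₁} {b₂} {c₁} {c₂} {v} {w} {u} c₁∉v c₂∉v btw x y x≺y-v x≺y-w =
  let x∈v = before⇒occurs₁ v x≺y-v
      x≺y-U = btw x y (before-∷ a₁ (a₂ ∷ v) (before-∷ a₂ v x≺y-v)) (before-∷ b₁ (b₂ ∷ w) (before-∷ b₂ w x≺y-w))
  in before-∷⁻ c₂ u (before-∷⁻ c₁ (c₂ ∷ u) x≺y-U (¬occurs-occurs⇒≢ {r = v} c₁∉v x∈v)) (¬occurs-occurs⇒≢ {r = v} c₂∉v x∈v)

-- Both x and y precede every other entry in v and in w, hence in u; so they must be u's first two entries.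
between-domino-heads : {x y c₁ c₂ : Fin n} {v w u : Vec (Fin n) m} →
  Distinct (x ∷ y ∷ v) → Distinct (c₁ ∷ c₂ ∷ u) → SameEntries (c₁ ∷ c₂ ∷ u) (x ∷ y ∷ v) → SameEntries w v →
  Between (x ∷ y ∷ v) (y ∷ x ∷ w) (c₁ ∷ c₂ ∷ u) → (c₁ ≡ x × c₂ ≡ y) ⊎ (c₁ ≡ y × c₂ ≡ x)
between-domino-heads {n = n} {m = m} {x = x} {y} {c₁} {c₂} {v} {w} {u} (x∉y∷v ∷ _) du@(c₁∉c₂∷u ∷ _) same same-w btw
  with c₁-is-x-or-y | c₂-is-x-or-y
  where
  U : Vec (Fin n) (suc (suc m))
  U = c₁ ∷ c₂ ∷ u
  in-v : ∀ c → occurs c U ≡ true → x ≢ c → y ≢ c → occurs c v ≡ true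
  in-v c c∈U x≢c y≢c = occurs-∷⁻ y v (occurs-∷⁻ x (y ∷ v) (trans (sym (same c)) c∈U) x≢c) y≢c
  x-first : ∀ c → occurs c v ≡ true → before U x c ≡ true
  x-first c c∈v =
    btw x c (before-head x (y ∷ v) (∨≡trueʳ (y == c) c∈v)) (before-∷ y (x ∷ w) (before-head x w (trans (same-w c) c∈v)))
  y-first : ∀ c → occurs c v ≡ true → before U y c ≡ true
  y-first c c∈v =
    btw y c (before-∷ x (y ∷ v) (before-head y v c∈v)) (before-head y (x ∷ w) (∨≡trueʳ (x == c) (trans (same-w c) c∈v)))
  c₁-is-x-or-y : c₁ ≡ x ⊎ c₁ ≡ y
  c₁-is-x-or-y with x FP.≟ c₁ | y FP.≟ c₁
  ... | yes x≡c₁ | _ = inj₁ (sym x≡c₁)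
  ... | no _ | yes y≡c₁ = inj₂ (sym y≡c₁)
  ... | no x≢c₁ | no y≢c₁ = ⊥-elim (¬before-head du (x-first c₁ (in-v c₁ (occurs-head c₁ (c₂ ∷ u)) x≢c₁ y≢c₁)))
  c₂-is-x-or-y : c₂ ≡ x ⊎ c₂ ≡ y
  c₂-is-x-or-y with x FP.≟ c₂ | y FP.≟ c₂
  ... | yes x≡c₂ | _ = inj₁ (sym x≡c₂)
  ... | no _ | yes y≡c₂ = inj₂ (sym y≡c₂)
  ... | no x≢c₂ | no y≢c₂ =
    let c₂∈v = in-v c₂ (∨≡trueʳ (c₁ == c₂) (occurs-head c₂ u)) x≢c₂ y≢c₂
    in ⊥-elim (¬occurs-head⇒≢ {r = v} x∉y∷v (trans (before-second⇒first du (x-first c₂ c₂∈v))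
                                          (sym (before-second⇒first du (y-first c₂ c₂∈v)))))
... | inj₁ refl | inj₂ refl = inj₁ (refl , refl)
... | inj₂ refl | inj₁ refl = inj₂ (refl , refl)
... | inj₁ refl | inj₁ refl = ⊥-elim (¬occurs-head⇒≢ {r = u} c₁∉c₂∷u refl)
... | inj₂ refl | inj₂ refl = ⊥-elim (¬occurs-head⇒≢ {r = u} c₁∉c₂∷u refl)

between⇒swapDominoes : (p : Tiling m) (v u : Vec (Fin n) m) → Distinct v → Distinct u → SameEntries u v →
                       Between v (swapAll p v) u → ∃ λ s → u ≡ swapDominoes p s v
between⇒swapDominoes empty [] [] _ _ _ _ = [] , refl
between⇒swapDominoes (mono p) (x ∷ v) (c ∷ u) (x∉v ∷ dv) du@(c∉u ∷ du′) same btw with c FP.≟ x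
... | no c≢x =
  let c∈v = occurs-∷⁻ x v (trans (sym (same c)) (occurs-head c u)) (c≢x ∘ sym)
      x≺c-w = before-head x (swapAll p v) (trans (occurs-swapDominoes p full v c) c∈v)
  in ⊥-elim (¬before-head du (btw x c (before-head x v c∈v) x≺c-w))
... | yes refl =
  let s , u≡ = between⇒swapDominoes p v u dv du′ (SameEntries-∷⁻ {u = u} {v} c∉u x∉v same)
                 (Between-∷⁻ {a = x} {x} {x} {v} {swapAll p v} {u} x∉v btw)
  in s , cong (c ∷_) u≡
between⇒swapDominoes (domino p) (x ∷ y ∷ v) (c₁ ∷ c₂ ∷ u) dv@(x∉y∷v ∷ y∉v ∷ dv′) du@(c₁∉c₂∷u ∷ c₂∉u ∷ du′) same btw
  with between-domino-heads {v = v} {swapAll p v} {u} dv du same (occurs-swapDominoes p full v) btw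
... | inj₁ (refl , refl) =
  let s , u≡ = between⇒swapDominoes p v u dv′ du′
                 (SameEntries-∷⁻ {u = u} {v} c₂∉u y∉v (SameEntries-∷⁻ {u = y ∷ u} {y ∷ v} c₁∉c₂∷u x∉y∷v same))
                 (Between-∷∷⁻ {a₁ = x} {y} {y} {x} {x} {y} {v} {swapAll p v} {u}
                              (proj₂ (¬occurs-∷⁻ {y = y} {v} x∉y∷v)) y∉v btw)
  in false ∷ s , cong (λ r → x ∷ y ∷ r) u≡
... | inj₂ (refl , refl) =
  let x∉v = proj₂ (¬occurs-∷⁻ {y = y} {v} x∉y∷v)
      y∉x∷v = trans (cong (_∨ occurs y v) (==-false (¬occurs-head⇒≢ {r = v} x∉y∷v))) y∉v
      same′ a = trans (same a) (sym (occurs-swapAdj (x ∷ y ∷ v) 0 a))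
      s , u≡ = between⇒swapDominoes p v u dv′ du′
                 (SameEntries-∷⁻ {u = u} {v} c₂∉u x∉v (SameEntries-∷⁻ {u = x ∷ u} {x ∷ v} c₁∉c₂∷u y∉x∷v same′))
                 (Between-∷∷⁻ {a₁ = x} {y} {y} {x} {y} {x} {v} {swapAll p v} {u} y∉v x∉v btw)
  in true ∷ s , cong (λ r → y ∷ x ∷ r) u≡

InversionsIncluded : Vec (Fin n) m → Vec (Fin n) m → Set
InversionsIncluded u u′ = ∀ a b → a <ᶠ b → before u b a ≡ true → before u′ b a ≡ true

⊆-∷ : {b b′ : Bool} {s s′ : Subset k} → (b ≡ true → b′ ≡ true) → s ⊆ s′ → (b ∷ s) ⊆ (b′ ∷ s′)
⊆-∷ {b = true} {true} _ _ here = here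
⊆-∷ {b = true} {false} b⇒b′ _ here with b⇒b′ refl
... | ()
⊆-∷ _ s⊆s′ (there x∈s) = there (s⊆s′ x∈s)

inversions⇒⊆ : (p : Tiling m) (v : Vec (Fin n) m) → AscentsAt p v → Distinct v → (s s′ : Subset (dominoes p)) →
               InversionsIncluded (swapDominoes p s v) (swapDominoes p s′ v) → s ⊆ s′
inversions⇒⊆ empty [] _ _ [] [] _ ()
inversions⇒⊆ (mono p) (x ∷ v) a (x∉v ∷ dv) s s′ incl = inversions⇒⊆ p v a dv s s′ tail
  where
  tail : InversionsIncluded (swapDominoes p s v) (swapDominoes p s′ v)
  tail c d c<d d≺c =
    before-∷⁻ x (swapDominoes p s′ v) (incl c d c<d (before-∷ x (swapDominoes p s v) d≺c))
              (¬occurs-occurs⇒≢ {r = v} x∉v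
                                (trans (sym (occurs-swapDominoes p s v d)) (before⇒occurs₁ (swapDominoes p s v) d≺c)))
inversions⇒⊆ (domino p) (x ∷ y ∷ v) (x<y , a) dv@(x∉y∷v ∷ y∉v ∷ dv′) (b ∷ s) (b′ ∷ s′) incl =
  ⊆-∷ head (inversions⇒⊆ p v a dv′ s s′ tail)
  where
  x∉v : occurs x v ≡ false
  x∉v = proj₂ (¬occurs-∷⁻ {y = y} {v} x∉y∷v)
  extend : ∀ c t {d e} → before (swapDominoes p t v) d e ≡ true →
           before (swapDominoes (domino p) (c ∷ t) (x ∷ y ∷ v)) d e ≡ true
  extend true t d≺e = before-∷ y (x ∷ swapDominoes p t v) (before-∷ x (swapDominoes p t v) d≺e)
  extend false t d≺e = before-∷ x (y ∷ swapDominoes p t v) (before-∷ y (swapDominoes p t v) d≺e)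
  restrict : ∀ c t {d e} → occurs d v ≡ true → before (swapDominoes (domino p) (c ∷ t) (x ∷ y ∷ v)) d e ≡ true →
             before (swapDominoes p t v) d e ≡ true
  restrict true t d∈v d≺e =
    before-∷⁻ x (swapDominoes p t v) (before-∷⁻ y (x ∷ swapDominoes p t v) d≺e (¬occurs-occurs⇒≢ {r = v} y∉v d∈v))
              (¬occurs-occurs⇒≢ {r = v} x∉v d∈v)
  restrict false t d∈v d≺e =
    before-∷⁻ y (swapDominoes p t v) (before-∷⁻ x (y ∷ swapDominoes p t v) d≺e (¬occurs-occurs⇒≢ {r = v} x∉v d∈v))
              (¬occurs-occurs⇒≢ {r = v} y∉v d∈v)
  tail : InversionsIncluded (swapDominoes p s v) (swapDominoes p s′ v)
  tail c d c<d d≺c =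
    restrict b′ s′ (trans (sym (occurs-swapDominoes p s v d)) (before⇒occurs₁ (swapDominoes p s v) d≺c))
                   (incl c d c<d (extend b s d≺c))
  swapped : ∀ c → before (swapDominoes (domino p) (c ∷ s′) (x ∷ y ∷ v)) y x ≡ true → c ≡ true
  swapped true _ = refl
  swapped false y≺x = ⊥-elim (¬before-head (Distinct-swapDominoes (domino p) (false ∷ s′) dv) y≺x)
  head : b ≡ true → b′ ≡ true
  head refl = swapped b′ (incl x y x<y (before-head y (x ∷ swapDominoes p s v) (occurs-head x (swapDominoes p s v))))

tiling-isBooleanInterval : {v : Vec (Fin n) n} → IsPerm n v → (p : Tiling n) → AscentsAt p v →
                           IsBooleanInterval n (dominoes p) v (swapAll p v)
tiling-isBooleanInterval {n} {v} pv p asc = pv , IsPerm-swapDominoes p full pv , φ , ψ , ψ-in , φψ , ψφ , iso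
  where
  ψ : Subset (dominoes p) → Vec (Fin n) n
  ψ s = swapDominoes p s v
  φ : Vec (Fin n) n → Subset (dominoes p)
  φ = descentSet p
  dv : Distinct v
  dv = IsPerm⇒Distinct pv
  ψ-in : ∀ s → InInterval n v (swapAll p v) (ψ s)
  ψ-in s = IsPerm-swapDominoes p s pv ,
           ≼⇒≤W pv (subst (_≼ ψ s) (swapDominoes-none p v) (swapDominoes-monotone p v asc SP.⊥⊆)) ,
           ≼⇒≤W (IsPerm-swapDominoes p s pv) (swapDominoes-monotone p v asc SP.⊆⊤)
  φψ : ∀ s → φ (ψ s) ≡ s
  φψ s = descentSet-swapDominoes p s v asc
  ψ-onto : ∀ u → InInterval n v (swapAll p v) u → ∃ λ s → u ≡ ψ s
  ψ-onto u (pu , v≤u , u≤w) =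
    between⇒swapDominoes p v u dv (IsPerm⇒Distinct pu)
                         (λ a → trans (IsPerm⇒occurs {u = u} pu a) (sym (IsPerm⇒occurs {u = v} pv a)))
                         (≼-between dv (≤W⇒≼ v≤u) (≤W⇒≼ u≤w))
  ψφ : ∀ u → InInterval n v (swapAll p v) u → ψ (φ u) ≡ u
  ψφ u u-in with ψ-onto u u-in
  ... | s , refl = cong ψ (φψ s)
  iso : ∀ u u′ → InInterval n v (swapAll p v) u → InInterval n v (swapAll p v) u′ → (u ≤W u′) ⇔ (φ u ⊆ φ u′)
  iso u u′ u-in u′-in with ψ-onto u u-in | ψ-onto u′ u′-in
  ... | s , refl | s′ , refl = mk⇔ ≤⇒⊆ ⊆⇒≤
    where
    ≤⇒⊆ : ψ s ≤W ψ s′ → φ (ψ s) ⊆ φ (ψ s′)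
    ≤⇒⊆ s≤s′ = subst₂ _⊆_ (sym (φψ s)) (sym (φψ s′))
      (inversions⇒⊆ p v asc dv s s′ λ a b a<b → ≼-keeps-inversion (IsPerm⇒Distinct (proj₁ u-in)) (≤W⇒≼ s≤s′) a<b)
    ⊆⇒≤ : φ (ψ s) ⊆ φ (ψ s′) → ψ s ≤W ψ s′
    ⊆⇒≤ φs⊆φs′ = ≼⇒≤W (proj₁ u-in) (swapDominoes-monotone p v asc (subst₂ _⊆_ (φψ s) (φψ s′) φs⊆φs′))


-- Every Boolean interval is spanned by a tiling

data DominoAt : Tiling n → ℕ → Set where
  at-0 : {p : Tiling n} → DominoAt (domino p) 0
  skip-mono : {p : Tiling n} {d : ℕ} → DominoAt p d → DominoAt (mono p) (suc d)
  skip-domino : {p : Tiling n} {d : ℕ} → DominoAt p d → DominoAt (domino p) (suc (suc d))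

data FreeAt : Tiling n → ℕ → Set where
  free-0 : {p : Tiling n} → FreeAt (mono (mono p)) 0
  skip-mono : {p : Tiling n} {j : ℕ} → FreeAt p j → FreeAt (mono p) (suc j)
  skip-domino : {p : Tiling n} {j : ℕ} → FreeAt p j → FreeAt (domino p) (suc (suc j))

allMono : (n : ℕ) → Tiling n
allMono zero = empty
allMono (suc n) = mono (allMono n)

dominoes-allMono : ∀ n → dominoes (allMono n) ≡ 0
dominoes-allMono zero = refl
dominoes-allMono (suc n) = dominoes-allMono n

swapAll-allMono : {A : Set} (v : Vec A n) → swapAll (allMono n) v ≡ v
swapAll-allMono [] = refl
swapAll-allMono (x ∷ v) = cong (x ∷_) (swapAll-allMono v)

AscentsAt-allMono : (v : Vec (Fin m) n) → AscentsAt (allMono n) v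
AscentsAt-allMono [] = tt
AscentsAt-allMono (x ∷ v) = AscentsAt-allMono v

¬DominoAt-allMono : ∀ n {d} → ¬ DominoAt (allMono n) d
¬DominoAt-allMono (suc n) (skip-mono D) = ¬DominoAt-allMono n D

insertDomino : {p : Tiling n} {j : ℕ} → FreeAt p j → Tiling n
insertDomino (free-0 {p = p}) = domino p
insertDomino (skip-mono f) = mono (insertDomino f)
insertDomino (skip-domino f) = domino (insertDomino f)

dominoes-insertDomino : {p : Tiling n} {j : ℕ} (f : FreeAt p j) → dominoes (insertDomino f) ≡ suc (dominoes p)
dominoes-insertDomino free-0 = refl
dominoes-insertDomino (skip-mono f) = dominoes-insertDomino f
dominoes-insertDomino (skip-domino f) = cong suc (dominoes-insertDomino f)

swapAdj-∷ : {A : Set} (x : A) (r : Vec A n) (j : ℕ) → swapAdj (x ∷ r) (suc j) ≡ x ∷ swapAdj r j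
swapAdj-∷ x [] j = refl
swapAdj-∷ x (y ∷ r) j = refl

swapAll-insertDomino : {A : Set} {p : Tiling n} {j : ℕ} (f : FreeAt p j) (v : Vec A n) →
                       swapAll (insertDomino f) v ≡ swapAdj (swapAll p v) j
swapAll-insertDomino free-0 (x ∷ y ∷ v) = refl
swapAll-insertDomino (skip-mono {p = p} {j} f) (x ∷ v) =
  trans (cong (x ∷_) (swapAll-insertDomino f v)) (sym (swapAdj-∷ x (swapAll p v) j))
swapAll-insertDomino (skip-domino {p = p} {j} f) (x ∷ y ∷ v) =
  trans (cong (λ r → y ∷ x ∷ r) (swapAll-insertDomino f v))
        (sym (trans (swapAdj-∷ y (x ∷ swapAll p v) (suc j)) (cong (y ∷_) (swapAdj-∷ x (swapAll p v) j))))

ascent-∷⁻ : (x : Fin m) (r : Vec (Fin m) n) (j : ℕ) → AscentAt (x ∷ r) (suc j) → AscentAt r j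
ascent-∷⁻ x (y ∷ r) j a = a

AscentsAt-insertDomino : {p : Tiling n} {j : ℕ} (f : FreeAt p j) (v : Vec (Fin m) n) →
                         AscentAt v j → AscentsAt p v → AscentsAt (insertDomino f) v
AscentsAt-insertDomino free-0 (x ∷ y ∷ v) x<y a = x<y , a
AscentsAt-insertDomino (skip-mono {j = j} f) (x ∷ v) ascent a =
  AscentsAt-insertDomino f v (ascent-∷⁻ x v j ascent) a
AscentsAt-insertDomino (skip-domino {j = j} f) (x ∷ y ∷ v) ascent (x<y , a) =
  x<y , AscentsAt-insertDomino f v (ascent-∷⁻ y v j (ascent-∷⁻ x (y ∷ v) (suc j) ascent)) a

DominoAt-insertDomino : {p : Tiling n} {j d : ℕ} (f : FreeAt p j) → DominoAt (insertDomino f) d → DominoAt p d ⊎ d ≡ j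
DominoAt-insertDomino free-0 at-0 = inj₂ refl
DominoAt-insertDomino free-0 (skip-domino D) = inj₁ (skip-mono (skip-mono D))
DominoAt-insertDomino (skip-mono f) (skip-mono D) with DominoAt-insertDomino f D
... | inj₁ D′ = inj₁ (skip-mono D′)
... | inj₂ refl = inj₂ refl
DominoAt-insertDomino (skip-domino f) at-0 = inj₁ at-0
DominoAt-insertDomino (skip-domino f) (skip-domino D) with DominoAt-insertDomino f D
... | inj₁ D′ = inj₁ (skip-domino D′)
... | inj₂ refl = inj₂ refl

swapAll-PairAt-free : {A : Set} {p : Tiling n} {j : ℕ} {a b : A} → FreeAt p j → (v : Vec A n) →
                      PairAt v j a b → PairAt (swapAll p v) j a b
swapAll-PairAt-free free-0 (x ∷ y ∷ v) (here , there here) = here , there here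
swapAll-PairAt-free (skip-mono f) (x ∷ v) (there pa , there pb) =
  let (pa′ , pb′) = swapAll-PairAt-free f v (pa , pb) in there pa′ , there pb′
swapAll-PairAt-free (skip-domino f) (x ∷ y ∷ v) (there (there pa) , there (there pb)) =
  let (pa′ , pb′) = swapAll-PairAt-free f v (pa , pb) in there (there pa′) , there (there pb′)

FreeAt-away-from-dominoes : (p : Tiling n) (j : ℕ) → suc j < n →
                            (∀ d → DominoAt p d → d ≢ j × d ≢ suc j × suc d ≢ j) → FreeAt p j
FreeAt-away-from-dominoes (mono (mono p)) zero _ _ = free-0
FreeAt-away-from-dominoes (mono (domino p)) zero _ clear = contradiction refl (proj₁ (proj₂ (clear 1 (skip-mono at-0))))
FreeAt-away-from-dominoes (mono p) (suc j) (s≤s j+1<n) clear =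
  skip-mono (FreeAt-away-from-dominoes p j j+1<n λ d D →
    let (d≢ , d≢′ , d≢″) = clear (suc d) (skip-mono D) in d≢ ∘ cong suc , d≢′ ∘ cong suc , d≢″ ∘ cong suc)
FreeAt-away-from-dominoes (domino p) zero _ clear = contradiction refl (proj₁ (clear 0 at-0))
FreeAt-away-from-dominoes (domino p) (suc zero) _ clear = contradiction refl (proj₂ (proj₂ (clear 0 at-0)))
FreeAt-away-from-dominoes (domino p) (suc (suc j)) (s≤s (s≤s j+1<n)) clear =
  skip-domino (FreeAt-away-from-dominoes p j j+1<n λ d D →
    let (d≢ , d≢′ , d≢″) = clear (2 + d) (skip-domino D)
    in d≢ ∘ cong (2 +_) , d≢′ ∘ cong (2 +_) , d≢″ ∘ cong (2 +_))

ascent-bound : (u : Vec (Fin n) m) (j : ℕ) → AscentAt u j → suc j < m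
ascent-bound (x ∷ y ∷ r) zero _ = s≤s (s≤s z≤n)
ascent-bound (x ∷ y ∷ r) (suc j) a = s≤s (ascent-bound (y ∷ r) j a)

-- With a b c at positions j, j+1, j+2 of v, the pair b, c is reversed above swapAdj v (suc j) but sits at the
-- non-adjacent positions j, j+2 of swapAdj v j, so no single adjacent swap of swapAdj v j reverses it.
adjacent-atoms-no-cover : {v : Vec (Fin n) m} {j i : ℕ} → Distinct v → AscentAt v j → AscentAt v (suc j) →
                          AscentAt (swapAdj v j) i → swapAdj v (suc j) ≼ swapAdj (swapAdj v j) i → ⊥
adjacent-atoms-no-cover {v = v} {j} {i} dv ascent-j ascent-j+1 ascent-i above
  with ascent⇒PairAt v j ascent-j | ascent⇒PairAt v (suc j) ascent-j+1
... | a , b , (a-at-j , b-at-j+1) , _ | b′ , c , (b′-at-j+1 , c-at-j+2) , b′<c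
  with At-functional b-at-j+1 b′-at-j+1
... | refl =
  let v′ = swapAdj v j
      dv′ = Distinct-swapAdj j dv
      (b-at-j , a-at-j+1) = swapAdj-PairAt (a-at-j , b-at-j+1)
      c-at-j+2′ = swapAdj-At-elsewhere (a-at-j , b-at-j+1) c-at-j+2 (NP.m≢1+n+m j {1} ∘ sym) NP.1+n≢n
      c≺b = ≼-keeps-inversion (Distinct-swapAdj (suc j) dv) above b′<c (before-swapAdj-PairAt (b-at-j+1 , c-at-j+2))
      (x , y , pair-i , _) = ascent⇒PairAt v′ i ascent-i
      (b≡x , c≡y) = swapAdj-reverses-only-pair dv′ pair-i (At⇒before b-at-j c-at-j+2′ (NP.n≤1+n (suc j))) c≺b
      i≡j = At-injective dv′ (subst (At v′ i) (sym b≡x) (proj₁ pair-i)) b-at-j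
      c≡a = At-functional (subst (At v′ (suc i)) (sym c≡y) (proj₂ pair-i)) (subst (λ i → At v′ (suc i) a) (sym i≡j) a-at-j+1)
  in NP.m≢1+n+m j {1} (At-injective dv a-at-j (subst (At v (suc (suc j))) c≡a c-at-j+2))

-- The pair a, b is reversed above the atom, so the cover of u must be the swap of that very pair.
cover-above-atom : {v u : Vec (Fin n) m} {j i : ℕ} {a b : Fin n} → Distinct v → Distinct u →
                   PairAt v j a b → a <ᶠ b → PairAt u j a b → AscentAt u i → swapAdj v j ≼ swapAdj u i → i ≡ j
cover-above-atom {u = u} {i = i} dv du pair-v a<b pair-u ascent-i above =
  let b≺a = ≼-keeps-inversion (Distinct-swapAdj _ dv) above a<b (before-swapAdj-PairAt pair-v)
      (x , y , pair-i , _) = ascent⇒PairAt u i ascent-i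
      (a≡x , _) = swapAdj-reverses-only-pair du pair-i (PairAt⇒before pair-u) b≺a
  in At-injective du (subst (At u i) (sym a≡x) (proj₁ pair-i)) (proj₁ pair-u)

Star-uncons : {A : Set} {R : A → A → Set} {x y : A} → Star R x y → x ≡ y ⊎ ∃ λ z → R x z × Star R z y
Star-uncons ε = inj₁ refl
Star-uncons (r ◅ s) = inj₂ (_ , r , s)

⊆-between-insert : {S R : Subset k} {x : Fin k} → S ⊆ R → R ⊆ S ∪ ⁅ x ⁆ → R ≢ S → R ≡ S ∪ ⁅ x ⁆
⊆-between-insert {S = S} {R} {x} S⊆R R⊆S∪x R≢S with x SP.∈? R
... | yes x∈R = SP.⊆-antisym R⊆S∪x S∪x⊆R
  where
  S∪x⊆R : S ∪ ⁅ x ⁆ ⊆ R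
  S∪x⊆R y∈ with SP.x∈p∪q⁻ S ⁅ x ⁆ y∈
  ... | inj₁ y∈S = S⊆R y∈S
  ... | inj₂ y∈x rewrite SP.x∈⁅y⁆⇒x≡y x y∈x = x∈R
... | no x∉R = contradiction (SP.⊆-antisym R⊆S S⊆R) R≢S
  where
  R⊆S : R ⊆ S
  R⊆S y∈R with SP.x∈p∪q⁻ S ⁅ x ⁆ (R⊆S∪x y∈R)
  ... | inj₁ y∈S = y∈S
  ... | inj₂ y∈x rewrite SP.x∈⁅y⁆⇒x≡y x y∈x = contradiction y∈R x∉R

below : ℕ → Subset k
below t = tabulate λ z → toℕ z <ᵇ t

∈-below⁻ : {z : Fin k} {t : ℕ} → z ∈ below t → toℕ z < t
∈-below⁻ {z = z} {t} z∈ =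
  NP.<ᵇ⇒< (toℕ z) t (Equivalence.from BP.T-≡ (trans (sym (VP.lookup∘tabulate _ z)) (VP.[]=⇒lookup z∈)))

∈-below⁺ : {z : Fin k} {t : ℕ} → toℕ z < t → z ∈ below t
∈-below⁺ {z = z} z<t = VP.lookup⇒[]= z _ (trans (VP.lookup∘tabulate _ z) (Equivalence.to BP.T-≡ (NP.<⇒<ᵇ z<t)))

below-zero : below {k} 0 ≡ none
below-zero = SP.⊆-antisym (λ z∈ → contradiction (∈-below⁻ z∈) NP.n≮0) SP.⊥⊆

below-all : below {k} k ≡ full
below-all = SP.⊆-antisym SP.⊆⊤ (λ {z} _ → ∈-below⁺ (FP.toℕ<n z))

fromℕ<∉below : {t : ℕ} (t<k : t < k) → fromℕ< t<k ∉ below t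
fromℕ<∉below t<k x∈ = NP.<-irrefl (FP.toℕ-fromℕ< t<k) (∈-below⁻ x∈)

below-suc : {t : ℕ} (t<k : t < k) → below (suc t) ≡ below t ∪ ⁅ fromℕ< t<k ⁆
below-suc {k = k} {t = t} t<k = SP.⊆-antisym into-∪ from-∪
  where
  x : Fin k
  x = fromℕ< t<k
  into-∪ : below (suc t) ⊆ below t ∪ ⁅ x ⁆
  into-∪ {z} z∈ with NP.m≤n⇒m<n∨m≡n (ℕ.s≤s⁻¹ (∈-below⁻ z∈))
  ... | inj₁ z<t = SP.p⊆p∪q ⁅ x ⁆ (∈-below⁺ z<t)
  ... | inj₂ z≡t rewrite FP.toℕ-injective (trans z≡t (sym (FP.toℕ-fromℕ< t<k))) = SP.q⊆p∪q (below t) ⁅ x ⁆ (SP.x∈⁅x⁆ x)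
  from-∪ : below t ∪ ⁅ x ⁆ ⊆ below (suc t)
  from-∪ z∈ with SP.x∈p∪q⁻ (below t) ⁅ x ⁆ z∈
  ... | inj₁ z∈below = ∈-below⁺ (NP.m<n⇒m<1+n (∈-below⁻ z∈below))
  ... | inj₂ z∈x rewrite SP.x∈⁅y⁆⇒x≡y x z∈x = ∈-below⁺ (subst (_< suc t) (sym (FP.toℕ-fromℕ< t<k)) (NP.n<1+n t))

module BooleanInterval {v w : Vec (Fin n) n} (B : IsBooleanInterval n k v w) where
  pv : IsPerm n v
  pv = proj₁ B
  pw : IsPerm n w
  pw = proj₁ (proj₂ B)
  φ : Vec (Fin n) n → Subset k
  φ = proj₁ (proj₂ (proj₂ B))
  ψ : Subset k → Vec (Fin n) n
  ψ = proj₁ (proj₂ (proj₂ (proj₂ B)))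
  ψ-in : ∀ S → InInterval n v w (ψ S)
  ψ-in = proj₁ (proj₂ (proj₂ (proj₂ (proj₂ B))))
  φψ : ∀ S → φ (ψ S) ≡ S
  φψ = proj₁ (proj₂ (proj₂ (proj₂ (proj₂ (proj₂ B)))))
  ψφ : ∀ u → InInterval n v w u → ψ (φ u) ≡ u
  ψφ = proj₁ (proj₂ (proj₂ (proj₂ (proj₂ (proj₂ (proj₂ B))))))
  iso : ∀ u u′ → InInterval n v w u → InInterval n v w u′ → (u ≤W u′) ⇔ (φ u ⊆ φ u′)
  iso = proj₂ (proj₂ (proj₂ (proj₂ (proj₂ (proj₂ (proj₂ B))))))

  dv : Distinct v
  dv = IsPerm⇒Distinct pv

  dψ : ∀ S → Distinct (ψ S)
  dψ S = IsPerm⇒Distinct (proj₁ (ψ-in S))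

  φ-mono : ∀ {u u′} → InInterval n v w u → InInterval n v w u′ → u ≤W u′ → φ u ⊆ φ u′
  φ-mono u-in u′-in = Equivalence.to (iso _ _ u-in u′-in)

  ψ-mono : ∀ {S T} → S ⊆ T → ψ S ≤W ψ T
  ψ-mono {S} {T} S⊆T = Equivalence.from (iso (ψ S) (ψ T) (ψ-in S) (ψ-in T)) (subst₂ _⊆_ (sym (φψ S)) (sym (φψ T)) S⊆T)

  ψ-injective : ∀ {S T} → ψ S ≡ ψ T → S ≡ T
  ψ-injective {S} {T} e = trans (sym (φψ S)) (trans (cong φ e) (φψ T))

  -- Some first cover above ψ S stays below ψ (S ∪ ⁅ x ⁆); as S ⊂ φ t ⊆ S ∪ ⁅ x ⁆, that cover is ψ (S ∪ ⁅ x ⁆) itself.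
  insert-cover : ∀ S x → x ∉ S → ∃ λ i → AscentAt (ψ S) i × ψ (S ∪ ⁅ x ⁆) ≡ swapAdj (ψ S) i
  insert-cover S x x∉S with Star-uncons (ψ-mono {S} {S ∪ ⁅ x ⁆} (SP.p⊆p∪q ⁅ x ⁆))
  ... | inj₁ ψS≡ψT = contradiction (subst (x ∈_) (sym (ψ-injective ψS≡ψT)) (SP.q⊆p∪q S ⁅ x ⁆ (SP.x∈⁅x⁆ x))) x∉S
  ... | inj₂ (t , cover@(_ , i , ascent , t≡) , t≤T) =
    i , ascent , trans (cong ψ (sym φt≡T)) (trans (ψφ t t-in) t≡)
    where
    T : Subset k
    T = S ∪ ⁅ x ⁆
    t-in : InInterval n v w t
    t-in = ≤W-IsPermˡ t≤T (proj₁ (ψ-in T)) , proj₁ (proj₂ (ψ-in S)) ◅◅ (cover ◅ ε) , t≤T ◅◅ proj₂ (proj₂ (ψ-in T))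
    φt≡T : φ t ≡ T
    φt≡T = ⊆-between-insert (subst (_⊆ φ t) (φψ S) (φ-mono (ψ-in S) t-in (cover ◅ ε)))
                            (subst (φ t ⊆_) (φψ T) (φ-mono t-in (ψ-in T) t≤T))
                            (λ φt≡S → swapAdj-ascent-≢ (dψ S) ascent
                                        (trans (sym t≡) (trans (sym (ψφ t t-in)) (cong ψ φt≡S))))

  v-in : InInterval n v w v
  v-in = pv , ε , proj₁ (proj₂ (ψ-in none)) ◅◅ proj₂ (proj₂ (ψ-in none))

  w-in : InInterval n v w w
  w-in = pw , proj₁ (proj₂ (ψ-in full)) ◅◅ proj₂ (proj₂ (ψ-in full)) , ε

  ψ-none : ψ none ≡ v
  ψ-none = trans (cong ψ (sym φv≡none)) (ψφ v v-in)
    where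
    φv≡none : φ v ≡ none
    φv≡none = SP.⊆-antisym (subst (φ v ⊆_) (φψ none) (φ-mono v-in (ψ-in none) (proj₁ (proj₂ (ψ-in none))))) SP.⊥⊆

  ψ-full : ψ full ≡ w
  ψ-full = trans (cong ψ (sym φw≡full)) (ψφ w w-in)
    where
    φw≡full : φ w ≡ full
    φw≡full = SP.⊆-antisym SP.⊆⊤ (subst (_⊆ φ w) (φψ full) (φ-mono (ψ-in full) w-in (proj₂ (proj₂ (ψ-in full)))))

  atom : ∀ x → ∃ λ j → AscentAt v j × ψ ⁅ x ⁆ ≡ swapAdj v j
  atom x with insert-cover none x SP.∉⊥
  ... | j , ascent , ψ≡ =
    j , subst (λ u → AscentAt u j) ψ-none ascent ,
    trans (cong ψ (sym (SP.∪-identityˡ ⁅ x ⁆))) (trans ψ≡ (cong (λ u → swapAdj u j) ψ-none))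

  position : Fin k → ℕ
  position x = proj₁ (atom x)

  position-ascent : ∀ x → AscentAt v (position x)
  position-ascent x = proj₁ (proj₂ (atom x))

  ψ-atom : ∀ x → ψ ⁅ x ⁆ ≡ swapAdj v (position x)
  ψ-atom x = proj₂ (proj₂ (atom x))

  position-injective : ∀ x y → position x ≡ position y → x ≡ y
  position-injective x y e =
    SP.x∈⁅y⁆⇒x≡y y (subst (x ∈_) (ψ-injective (trans (ψ-atom x) (trans (cong (swapAdj v) e) (sym (ψ-atom y))))) (SP.x∈⁅x⁆ x))

  position-nonadjacent : ∀ x y → x ≢ y → position y ≢ suc (position x)
  position-nonadjacent x y x≢y e with insert-cover ⁅ x ⁆ y (x≢y ∘ sym ∘ SP.x∈⁅y⁆⇒x≡y x)
  ... | i , ascent , ψ≡ =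
    adjacent-atoms-no-cover dv (position-ascent x) (subst (AscentAt v) e (position-ascent y))
      (subst (λ u → AscentAt u i) (ψ-atom x) ascent)
      (subst₂ _≼_ (trans (ψ-atom y) (cong (swapAdj v) e)) (trans ψ≡ (cong (λ u → swapAdj u i) (ψ-atom x)))
              (≤W⇒≼ (ψ-mono (SP.q⊆p∪q ⁅ x ⁆ ⁅ y ⁆))))

  Stage : ℕ → Set
  Stage t = ∃ λ p → dominoes p ≡ t × AscentsAt p v × ψ (below t) ≡ swapAll p v ×
                    (∀ d → DominoAt p d → ∃ λ r → toℕ r < t × d ≡ position r)

  stage-0 : Stage 0
  stage-0 = allMono n , dominoes-allMono n , AscentsAt-allMono v ,
            trans (cong ψ below-zero) (trans ψ-none (sym (swapAll-allMono v))) ,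
            λ d D → ⊥-elim (¬DominoAt-allMono n D)

  -- The atom at position j lies below ψ (below (suc t)), so the cover from ψ (below t) is the swap at j.
  stage-suc : ∀ {t} (t<k : t < k) → Stage t → Stage (suc t)
  stage-suc {t} t<k (p , #p , ascents , ψ≡ , dominoes-seen) =
    insertDomino free , trans (dominoes-insertDomino free) (cong suc #p) ,
    AscentsAt-insertDomino free v (position-ascent x) ascents , ψ-step , dominoes-seen′
    where
    x : Fin k
    x = fromℕ< t<k
    j : ℕ
    j = position x
    clear : ∀ d → DominoAt p d → d ≢ j × d ≢ suc j × suc d ≢ j
    clear d D with dominoes-seen d D
    ... | r , r<t , refl =
      (r≢x ∘ position-injective r x) , position-nonadjacent x r (r≢x ∘ sym) , position-nonadjacent r x r≢x ∘ sym
      where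
      r≢x : r ≢ x
      r≢x r≡x = NP.<-irrefl (trans (cong toℕ r≡x) (FP.toℕ-fromℕ< t<k)) r<t
    free : FreeAt p j
    free = FreeAt-away-from-dominoes p j (ascent-bound v j (position-ascent x)) clear
    ψ-step : ψ (below (suc t)) ≡ swapAll (insertDomino free) v
    ψ-step with insert-cover (below t) x (fromℕ<∉below t<k) | ascent⇒PairAt v j (position-ascent x)
    ... | i , ascent-i , ψ≡′ | a , b , pair-v , a<b = begin
      ψ (below (suc t))         ≡⟨ cong ψ (below-suc t<k) ⟩
      ψ (below t ∪ ⁅ x ⁆)       ≡⟨ ψ≡′ ⟩
      swapAdj (ψ (below t)) i   ≡⟨ cong (swapAdj (ψ (below t))) i≡j ⟩
      swapAdj (ψ (below t)) j   ≡⟨ cong (λ u → swapAdj u j) ψ≡ ⟩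
      swapAdj (swapAll p v) j   ≡⟨ swapAll-insertDomino free v ⟨
      swapAll (insertDomino free) v ∎
      where
      open ≡-Reasoning
      pair-u : PairAt (ψ (below t)) j a b
      pair-u = subst (λ u → PairAt u j a b) (sym ψ≡) (swapAll-PairAt-free free v pair-v)
      above : swapAdj v j ≼ swapAdj (ψ (below t)) i
      above = subst₂ _≼_ (ψ-atom x) ψ≡′ (≤W⇒≼ (ψ-mono (SP.q⊆p∪q (below t) ⁅ x ⁆)))
      i≡j : i ≡ j
      i≡j = cover-above-atom dv (dψ (below t)) pair-v a<b pair-u ascent-i above
    dominoes-seen′ : ∀ d → DominoAt (insertDomino free) d → ∃ λ r → toℕ r < suc t × d ≡ position r
    dominoes-seen′ d D with DominoAt-insertDomino free D
    ... | inj₁ D′ = let r , r<t , d≡ = dominoes-seen d D′ in r , NP.m<n⇒m<1+n r<t , d≡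
    ... | inj₂ refl = x , subst (_< suc t) (sym (FP.toℕ-fromℕ< t<k)) (NP.n<1+n t) , refl

  stage : ∀ t → t ≤ k → Stage t
  stage zero _ = stage-0
  stage (suc t) t<k = stage-suc t<k (stage t (NP.<⇒≤ t<k))

  tiling : Σ (Tiling n) λ p → dominoes p ≡ k × AscentsAt p v × w ≡ swapAll p v
  tiling =
    let p , #p , ascents , ψ≡ , _ = stage k NP.≤-refl
    in p , #p , ascents , trans (sym ψ-full) (trans (cong ψ (sym below-all)) ψ≡)

booleanInterval⇒tiling : {v w : Vec (Fin n) n} → IsBooleanInterval n k v w →
                         Σ (Tiling n) λ p → dominoes p ≡ k × AscentsAt p v × w ≡ swapAll p v
booleanInterval⇒tiling = BooleanInterval.tiling

-- Counting

Card : Set → ℕ → Set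
Card A c = A ↔ Fin c

card-↔ : {A B : Set} {c : ℕ} → A ↔ B → Card B c → Card A c
card-↔ = ↔-trans

card-unique : {A : Set} {a b : ℕ} → Card A a → Card A b → a ≡ b
card-unique CA CB = ↔⇒≡ (↔-trans (↔-sym CA) CB)

card-Fin : Card (Fin n) n
card-Fin = ↔-refl

card-⊤ : Card ⊤ 1
card-⊤ = ↔-sym FP.1↔⊤

card-empty : {A : Set} → ¬ A → Card A 0
card-empty ¬a = mk↔ₛ′ (λ a → ⊥-elim (¬a a)) (λ ()) (λ ()) (λ a → ⊥-elim (¬a a))

card-⊎ : {A B : Set} {a b : ℕ} → Card A a → Card B b → Card (A ⊎ B) (a + b)
card-⊎ CA CB = ↔-trans (CA ⊎-↔ CB) (↔-sym FP.+↔⊎)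

card-× : {A B : Set} {a b : ℕ} → Card A a → Card B b → Card (A × B) (a * b)
card-× CA CB = ↔-trans (CA ×-↔ CB) (↔-sym FP.*↔×)

card-Vec : {A : Set} {a : ℕ} → Card A a → ∀ m → Card (Vec A m) (a ^ m)
card-Vec CA zero = card-↔ (mk↔ₛ′ (λ _ → tt) (λ _ → []) (λ _ → refl) (λ { [] → refl })) card-⊤
card-Vec {A = A} CA (suc m) = card-↔ (mk↔ₛ′ uncons (λ (x , r) → x ∷ r) (λ _ → refl) (λ { (x ∷ r) → refl }))
                                      (card-× CA (card-Vec CA m))
  where
  uncons : Vec A (suc m) → A × Vec A m
  uncons (x ∷ r) = x , r

card-Subset : ∀ k → Card (Subset k) (2 ^ k)
card-Subset = card-Vec (↔-sym FP.2↔Bool)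

subtype-≡ : {A : Set} {P : A → Bool} {x y : A} {px : P x ≡ true} {py : P y ≡ true} →
            x ≡ y → _≡_ {A = Σ A λ z → P z ≡ true} (x , px) (y , py)
subtype-≡ refl = cong (_ ,_) (Bool-UIP.≡-irrelevant _ _)

card-filterFin : ∀ a (P : Fin a → Bool) → ∃ λ c → Card (Σ (Fin a) λ i → P i ≡ true) c
card-filterFin zero P = 0 , card-empty λ { (() , _) }
card-filterFin (suc a) P with card-filterFin a (P ∘ suc) | P zero in P0
... | c , size | true = suc c , card-↔ (mk↔ₛ′ to from to∘from from∘to) (card-⊎ card-⊤ size)
  where
  to : Σ (Fin (suc a)) (λ i → P i ≡ true) → ⊤ ⊎ Σ (Fin a) λ i → P (suc i) ≡ true
  to (zero , _) = inj₁ tt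
  to (suc i , e) = inj₂ (i , e)
  from : ⊤ ⊎ Σ (Fin a) (λ i → P (suc i) ≡ true) → Σ (Fin (suc a)) λ i → P i ≡ true
  from (inj₁ _) = zero , P0
  from (inj₂ (i , e)) = suc i , e
  to∘from : ∀ z → to (from z) ≡ z
  to∘from (inj₁ tt) = refl
  to∘from (inj₂ _) = refl
  from∘to : ∀ z → from (to z) ≡ z
  from∘to (zero , e) = subtype-≡ refl
  from∘to (suc i , e) = refl
... | c , size | false = c , card-↔ (mk↔ₛ′ to from (λ _ → refl) from∘to) size
  where
  to : Σ (Fin (suc a)) (λ i → P i ≡ true) → Σ (Fin a) λ i → P (suc i) ≡ true
  to (zero , e) = contradiction (trans (sym P0) e) λ ()
  to (suc i , e) = i , e
  from : Σ (Fin a) (λ i → P (suc i) ≡ true) → Σ (Fin (suc a)) λ i → P i ≡ true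
  from (i , e) = suc i , e
  from∘to : ∀ z → from (to z) ≡ z
  from∘to (zero , e) = contradiction (trans (sym P0) e) λ ()
  from∘to (suc i , e) = refl

card-filter : {A : Set} {a : ℕ} → Card A a → (P : A → Bool) → ∃ λ c → Card (Σ A λ x → P x ≡ true) c
card-filter {A} {a} CA P with card-filterFin a (P ∘ Inverse.from CA)
... | c , size = c , card-↔ (mk↔ₛ′ to′ from′ to∘from from∘to) size
  where
  open Inverse CA
  to′ : Σ A (λ x → P x ≡ true) → Σ (Fin a) λ i → P (from i) ≡ true
  to′ (x , e) = to x , trans (cong P (strictlyInverseʳ x)) e
  from′ : Σ (Fin a) (λ i → P (from i) ≡ true) → Σ A λ x → P x ≡ true
  from′ (i , e) = from i , e
  to∘from : ∀ z → to′ (from′ z) ≡ z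
  to∘from (i , e) = subtype-≡ (strictlyInverseˡ i)
  from∘to : ∀ z → from′ (to′ z) ≡ z
  from∘to (x , e) = subtype-≡ (strictlyInverseʳ x)

distinct : Vec (Fin n) m → Bool
distinct [] = true
distinct (x ∷ r) = not (occurs x r) ∧ distinct r

distinct⇒Distinct : (v : Vec (Fin n) m) → distinct v ≡ true → Distinct v
distinct⇒Distinct [] _ = []
distinct⇒Distinct (x ∷ r) e =
  let (x∉r , r-distinct) = ∧≡true⁻ {not (occurs x r)} e
  in not≡true⁻ x∉r ∷ distinct⇒Distinct r r-distinct

Distinct⇒distinct : {v : Vec (Fin n) m} → Distinct v → distinct v ≡ true
Distinct⇒distinct [] = refl
Distinct⇒distinct (x∉r ∷ d) rewrite x∉r = Distinct⇒distinct d

DistinctVec : ℕ → ℕ → Set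
DistinctVec a m = Σ (Vec (Fin a) m) λ v → distinct v ≡ true

fallingFactorial : ℕ → ℕ → ℕ
fallingFactorial a zero = 1
fallingFactorial zero (suc m) = 0
fallingFactorial (suc a) (suc m) = suc a * fallingFactorial a m

fallingFactorial-diag : ∀ n → fallingFactorial n n ≡ n !
fallingFactorial-diag zero = refl
fallingFactorial-diag (suc n) = cong (suc n *_) (fallingFactorial-diag n)

punchOutAll : ∀ {a} (x : Fin (suc a)) (r : Vec (Fin (suc a)) m) → occurs x r ≡ false → Vec (Fin a) m
punchOutAll x [] _ = []
punchOutAll x (y ∷ r) x∉y∷r =
  let (x≢y , x∉r) = ¬occurs-∷⁻ {y = y} {r} x∉y∷r in punchOut x≢y ∷ punchOutAll x r x∉r

map-punchIn-punchOutAll : ∀ {a} (x : Fin (suc a)) (r : Vec (Fin (suc a)) m) (x∉r : occurs x r ≡ false) →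
                          map (punchIn x) (punchOutAll x r x∉r) ≡ r
map-punchIn-punchOutAll x [] _ = refl
map-punchIn-punchOutAll x (y ∷ r) x∉y∷r =
  let (x≢y , x∉r) = ¬occurs-∷⁻ {y = y} {r} x∉y∷r
  in cong₂ _∷_ (FP.punchIn-punchOut x≢y) (map-punchIn-punchOutAll x r x∉r)

punchOutAll-map-punchIn : ∀ {a} (x : Fin (suc a)) (r : Vec (Fin a) m) (x∉r : occurs x (map (punchIn x) r) ≡ false) →
                          punchOutAll x (map (punchIn x) r) x∉r ≡ r
punchOutAll-map-punchIn x [] _ = refl
punchOutAll-map-punchIn x (z ∷ r) x∉z∷r =
  let (x≢z , x∉r) = ¬occurs-∷⁻ {y = punchIn x z} {map (punchIn x) r} x∉z∷r
  in cong₂ _∷_ (trans (FP.punchOut-cong x {i≢j = x≢z} {i≢k = FP.punchInᵢ≢i x z ∘ sym} refl) (FP.punchOut-punchIn x))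
               (punchOutAll-map-punchIn x r x∉r)

¬occurs-map-punchIn : ∀ {a} (x : Fin (suc a)) (r : Vec (Fin a) m) → occurs x (map (punchIn x) r) ≡ false
¬occurs-map-punchIn x [] = refl
¬occurs-map-punchIn x (z ∷ r) = cong₂ _∨_ (==-false (FP.punchInᵢ≢i x z)) (¬occurs-map-punchIn x r)

occurs-map-punchIn : ∀ {a} (x : Fin (suc a)) (z : Fin a) (r : Vec (Fin a) m) →
                     occurs (punchIn x z) (map (punchIn x) r) ≡ occurs z r
occurs-map-punchIn x z [] = refl
occurs-map-punchIn x z (y ∷ r) =
  cong₂ _∨_ (does-⇔ (mk⇔ (FP.punchIn-injective x y z) (cong (punchIn x))) (punchIn x y FP.≟ punchIn x z) (y FP.≟ z))
            (occurs-map-punchIn x z r)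

distinct-map-punchIn : ∀ {a} (x : Fin (suc a)) (r : Vec (Fin a) m) → distinct (map (punchIn x) r) ≡ distinct r
distinct-map-punchIn x [] = refl
distinct-map-punchIn x (z ∷ r) = cong₂ (λ p q → not p ∧ q) (occurs-map-punchIn x z r) (distinct-map-punchIn x r)

occurs-punchOutAll : ∀ {a} (x z : Fin (suc a)) (x≢z : x ≢ z) (r : Vec (Fin (suc a)) m) (x∉r : occurs x r ≡ false) →
                     occurs (punchOut x≢z) (punchOutAll x r x∉r) ≡ occurs z r
occurs-punchOutAll x z x≢z [] _ = refl
occurs-punchOutAll x z x≢z (y ∷ r) x∉y∷r =
  let (x≢y , x∉r) = ¬occurs-∷⁻ {y = y} {r} x∉y∷r
  in cong₂ _∨_ (does-⇔ (mk⇔ (FP.punchOut-injective x≢y x≢z) (FP.punchOut-cong x))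
                       (punchOut x≢y FP.≟ punchOut x≢z) (y FP.≟ z))
               (occurs-punchOutAll x z x≢z r x∉r)

distinct-punchOutAll : ∀ {a} (x : Fin (suc a)) (r : Vec (Fin (suc a)) m) (x∉r : occurs x r ≡ false) →
                       distinct (punchOutAll x r x∉r) ≡ distinct r
distinct-punchOutAll x [] _ = refl
distinct-punchOutAll x (y ∷ r) x∉y∷r =
  let (x≢y , x∉r) = ¬occurs-∷⁻ {y = y} {r} x∉y∷r
  in cong₂ (λ p q → not p ∧ q) (occurs-punchOutAll x y x≢y r x∉r) (distinct-punchOutAll x r x∉r)

card-DistinctVec : ∀ a m → Card (DistinctVec a m) (fallingFactorial a m)
card-DistinctVec a zero =
  card-↔ (mk↔ₛ′ (λ _ → tt) (λ _ → [] , refl) (λ _ → refl) (λ { ([] , refl) → refl })) card-⊤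
card-DistinctVec zero (suc m) = card-empty λ { (() ∷ _ , _) }
card-DistinctVec (suc a) (suc m) =
  card-↔ (mk↔ₛ′ to from to∘from from∘to) (card-× card-Fin (card-DistinctVec a m))
  where
  to : DistinctVec (suc a) (suc m) → Fin (suc a) × DistinctVec a m
  to (x ∷ r , d) =
    let (x∉r , r-distinct) = ∧≡true⁻ {not (occurs x r)} d
    in x , punchOutAll x r (not≡true⁻ x∉r) , trans (distinct-punchOutAll x r _) r-distinct
  from : Fin (suc a) × DistinctVec a m → DistinctVec (suc a) (suc m)
  from (x , r , d) =
    x ∷ map (punchIn x) r ,
    cong₂ (λ p q → not p ∧ q) (¬occurs-map-punchIn x r) (trans (distinct-map-punchIn x r) d)
  to∘from : ∀ z → to (from z) ≡ z
  to∘from (x , r , _) = cong (x ,_) (subtype-≡ (punchOutAll-map-punchIn x r _))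
  from∘to : ∀ z → from (to z) ≡ z
  from∘to (x ∷ r , _) = subtype-≡ (cong (x ∷_) (map-punchIn-punchOutAll x r _))

card-Perm : ∀ n → Card (DistinctVec n n) (n !)
card-Perm n = subst (Card (DistinctVec n n)) (fallingFactorial-diag n) (card-DistinctVec n n)

ascentsAtᵇ : Tiling n → Vec (Fin m) n → Bool
ascentsAtᵇ empty [] = true
ascentsAtᵇ (mono p) (x ∷ v) = ascentsAtᵇ p v
ascentsAtᵇ (domino p) (x ∷ y ∷ v) = (x <ᵇᶠ y) ∧ ascentsAtᵇ p v

ascentsAtᵇ⇒AscentsAt : (p : Tiling n) (v : Vec (Fin m) n) → ascentsAtᵇ p v ≡ true → AscentsAt p v
ascentsAtᵇ⇒AscentsAt empty [] _ = tt
ascentsAtᵇ⇒AscentsAt (mono p) (x ∷ v) e = ascentsAtᵇ⇒AscentsAt p v e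
ascentsAtᵇ⇒AscentsAt (domino p) (x ∷ y ∷ v) e =
  let (x<y , rest) = ∧≡true⁻ {x <ᵇᶠ y} e
  in does≡true⇒ (x FP.<? y) x<y , ascentsAtᵇ⇒AscentsAt p v rest

AscentsAt⇒ascentsAtᵇ : (p : Tiling n) (v : Vec (Fin m) n) → AscentsAt p v → ascentsAtᵇ p v ≡ true
AscentsAt⇒ascentsAtᵇ empty [] _ = refl
AscentsAt⇒ascentsAtᵇ (mono p) (x ∷ v) a = AscentsAt⇒ascentsAtᵇ p v a
AscentsAt⇒ascentsAtᵇ (domino p) (x ∷ y ∷ v) (x<y , a) =
  cong₂ _∧_ (dec-true (x FP.<? y) x<y) (AscentsAt⇒ascentsAtᵇ p v a)

swapDominoes-involutive : {A : Set} (p : Tiling n) (s : Subset (dominoes p)) (v : Vec A n) →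
                          swapDominoes p s (swapDominoes p s v) ≡ v
swapDominoes-involutive empty [] [] = refl
swapDominoes-involutive (mono p) s (x ∷ v) = cong (x ∷_) (swapDominoes-involutive p s v)
swapDominoes-involutive (domino p) (true ∷ s) (x ∷ y ∷ v) = cong (λ r → x ∷ y ∷ r) (swapDominoes-involutive p s v)
swapDominoes-involutive (domino p) (false ∷ s) (x ∷ y ∷ v) = cong (λ r → x ∷ y ∷ r) (swapDominoes-involutive p s v)

AscentsAt-sortDominoes : (p : Tiling n) (u : Vec (Fin m) n) → Distinct u →
                         AscentsAt p (swapDominoes p (descentSet p u) u)
AscentsAt-sortDominoes empty [] _ = tt
AscentsAt-sortDominoes (mono p) (x ∷ u) (_ ∷ d) = AscentsAt-sortDominoes p u d
AscentsAt-sortDominoes (domino p) (x ∷ y ∷ u) (x∉y∷u ∷ _ ∷ d) = sorted (y <ᵇᶠ x) refl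
  where
  rest : AscentsAt p (swapDominoes p (descentSet p u) u)
  rest = AscentsAt-sortDominoes p u d
  sorted : ∀ b → b ≡ y <ᵇᶠ x → AscentsAt (domino p) (swapDominoes (domino p) (b ∷ descentSet p u) (x ∷ y ∷ u))
  sorted true e = does≡true⇒ (y FP.<? x) (sym e) , rest
  sorted false e with FP.<-cmp x y
  ... | tri< x<y _ _ = x<y , rest
  ... | tri≈ _ x≡y _ = contradiction x≡y (¬occurs-head⇒≢ {r = u} x∉y∷u)
  ... | tri> _ _ y<x = ⊥-elim (bool-clash (dec-true (y FP.<? x) y<x) (sym e))

AscentPerm : Tiling n → Set
AscentPerm {n} p = Σ (Vec (Fin n) n) λ v → (distinct v ∧ ascentsAtᵇ p v) ≡ true

AscentPerm⇒AscentsAt : (p : Tiling n) (v : Vec (Fin n) n) → (distinct v ∧ ascentsAtᵇ p v) ≡ true → AscentsAt p v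
AscentPerm⇒AscentsAt p v ok = ascentsAtᵇ⇒AscentsAt p v (proj₂ (∧≡true⁻ {distinct v} ok))

AscentPerm⇒Distinct : (p : Tiling n) (v : Vec (Fin n) n) → (distinct v ∧ ascentsAtᵇ p v) ≡ true → Distinct v
AscentPerm⇒Distinct p v ok = distinct⇒Distinct v (proj₁ (∧≡true⁻ {distinct v} ok))

-- A permutation is its dominoes sorted increasingly, together with the set of dominoes that were descents.
AscentPerm×Subset↔Perm : (p : Tiling n) → (AscentPerm p × Subset (dominoes p)) ↔ DistinctVec n n
AscentPerm×Subset↔Perm {n} p = mk↔ₛ′ to from to∘from from∘to
  where
  to : AscentPerm p × Subset (dominoes p) → DistinctVec n n
  to ((v , ok) , s) = swapDominoes p s v , Distinct⇒distinct (Distinct-swapDominoes p s (AscentPerm⇒Distinct p v ok))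
  from : DistinctVec n n → AscentPerm p × Subset (dominoes p)
  from (u , d) =
    let u-distinct = distinct⇒Distinct u d
    in (swapDominoes p (descentSet p u) u ,
        cong₂ _∧_ (Distinct⇒distinct (Distinct-swapDominoes p _ u-distinct))
                  (AscentsAt⇒ascentsAtᵇ p _ (AscentsAt-sortDominoes p u u-distinct))) ,
       descentSet p u
  to∘from : ∀ z → to (from z) ≡ z
  to∘from (u , _) = subtype-≡ (swapDominoes-involutive p (descentSet p u) u)
  from∘to : ∀ z → from (to z) ≡ z
  from∘to ((v , ok) , s) =
    let descents≡s = descentSet-swapDominoes p s v (AscentPerm⇒AscentsAt p v ok)
    in cong₂ _,_ (subtype-≡ (trans (cong (λ r → swapDominoes p r (swapDominoes p s v)) descents≡s)
                                   (swapDominoes-involutive p s v)))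
                 descents≡s

TilingWith : ℕ → ℕ → Set
TilingWith n k = Σ (Tiling n) λ p → dominoes p ≡ k

TilingWith-split : TilingWith (suc (suc n)) (suc k) ↔ (TilingWith (suc n) (suc k) ⊎ TilingWith n k)
TilingWith-split = mk↔ₛ′ to from to∘from from∘to
  where
  to : TilingWith (suc (suc n)) (suc k) → TilingWith (suc n) (suc k) ⊎ TilingWith n k
  to (mono p , e) = inj₁ (p , e)
  to (domino p , e) = inj₂ (p , NP.suc-injective e)
  from : TilingWith (suc n) (suc k) ⊎ TilingWith n k → TilingWith (suc (suc n)) (suc k)
  from (inj₁ (p , e)) = mono p , e
  from (inj₂ (p , e)) = domino p , cong suc e
  to∘from : ∀ z → to (from z) ≡ z
  to∘from (inj₁ _) = refl
  to∘from (inj₂ (p , e)) = cong (λ e → inj₂ (p , e)) (NP.≡-irrelevant _ _)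
  from∘to : ∀ z → from (to z) ≡ z
  from∘to (mono p , e) = refl
  from∘to (domino p , e) = cong (domino p ,_) (NP.≡-irrelevant _ _)

TilingWith-noDomino : TilingWith (suc (suc n)) 0 ↔ TilingWith (suc n) 0
TilingWith-noDomino = mk↔ₛ′ (λ { (mono p , e) → p , e }) (λ (p , e) → mono p , e) (λ _ → refl) (λ { (mono p , e) → refl })

C-recurrence : ∀ n k → (n ∸ k) C suc k + (n ∸ k) C k ≡ (suc n ∸ k) C suc k
C-recurrence n k with NP.≤-<-connex k n
... | inj₁ k≤n = begin
  (n ∸ k) C suc k + (n ∸ k) C k ≡⟨ NP.+-comm ((n ∸ k) C suc k) _ ⟩
  (n ∸ k) C k + (n ∸ k) C suc k ≡⟨ nCk+nC[k+1]≡[n+1]C[k+1] (n ∸ k) k ⟩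
  suc (n ∸ k) C suc k           ≡⟨ cong (_C suc k) (NP.+-∸-assoc 1 k≤n) ⟨
  (suc n ∸ k) C suc k           ∎
  where open ≡-Reasoning
... | inj₂ (s≤s n≤k) rewrite NP.m≤n⇒m∸n≡0 n≤k | NP.m≤n⇒m∸n≡0 (NP.m≤n⇒m≤1+n n≤k) = refl

card-TilingWith : ∀ n k → Card (TilingWith n k) ((n ∸ k) C k)
card-TilingWith zero zero =
  card-↔ (mk↔ₛ′ (λ _ → tt) (λ _ → empty , refl) (λ _ → refl) (λ { (empty , refl) → refl })) card-⊤
card-TilingWith zero (suc k) = card-empty λ { (empty , ()) }
card-TilingWith (suc zero) zero =
  card-↔ (mk↔ₛ′ (λ _ → tt) (λ _ → mono empty , refl) (λ _ → refl) (λ { (mono empty , refl) → refl })) card-⊤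
card-TilingWith (suc zero) (suc zero) = card-empty λ { (mono empty , ()) }
card-TilingWith (suc zero) (suc (suc k)) = card-empty λ { (mono empty , ()) }
card-TilingWith (suc (suc n)) zero = card-↔ TilingWith-noDomino (card-TilingWith (suc n) zero)
card-TilingWith (suc (suc n)) (suc k) =
  subst (Card _) (C-recurrence n k)
    (card-↔ TilingWith-split (card-⊎ (card-TilingWith (suc n) (suc k)) (card-TilingWith n k)))

swapAll-injective : (p q : Tiling n) (v : Vec (Fin m) n) → AscentsAt p v → AscentsAt q v →
                    swapAll p v ≡ swapAll q v → p ≡ q
swapAll-injective empty empty [] _ _ _ = refl
swapAll-injective (mono p) (mono q) (x ∷ v) a a′ e = cong mono (swapAll-injective p q v a a′ (VP.∷-injectiveʳ e))
swapAll-injective (domino p) (domino q) (x ∷ y ∷ v) (_ , a) (_ , a′) e =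
  cong domino (swapAll-injective p q v a a′ (VP.∷-injectiveʳ (VP.∷-injectiveʳ e)))
swapAll-injective (mono p) (domino q) (x ∷ y ∷ v) _ (x<y , _) e = contradiction (VP.∷-injectiveˡ e) (FP.<⇒≢ x<y)
swapAll-injective (domino p) (mono q) (x ∷ y ∷ v) (x<y , _) _ e = contradiction (sym (VP.∷-injectiveˡ e)) (FP.<⇒≢ x<y)

IntervalCode : ℕ → ℕ → Set
IntervalCode n k = Σ (TilingWith n k) λ (p , _) → AscentPerm p

endpoints : IntervalCode n k → Vec (Fin n) n × Vec (Fin n) n
endpoints ((p , _) , (v , _)) = v , swapAll p v

endpoints-injective : (d d′ : IntervalCode n k) → endpoints d ≡ endpoints d′ → d ≡ d′
endpoints-injective ((p , tw) , (v , ok)) ((q , tw′) , (v′ , ok′)) e with ,-injectiveˡ e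
... | refl with swapAll-injective p q v (AscentPerm⇒AscentsAt p v ok) (AscentPerm⇒AscentsAt q v ok′) (,-injectiveʳ e)
... | refl = cong₂ (λ tw ok → (p , tw) , (v , ok)) (NP.≡-irrelevant tw tw′) (Bool-UIP.≡-irrelevant ok ok′)

isBooleanInterval⇔endpoints : (v w : Vec (Fin n) n) →
                              IsBooleanInterval n k v w ⇔ (∃ λ (d : IntervalCode n k) → endpoints d ≡ (v , w))
isBooleanInterval⇔endpoints {n} {k} v w = mk⇔ toData fromData
  where
  toData : IsBooleanInterval n k v w → ∃ λ (d : IntervalCode n k) → endpoints d ≡ (v , w)
  toData B with booleanInterval⇒tiling B
  ... | p , refl , ascents , refl =
    ((p , refl) , (v , cong₂ _∧_ (Distinct⇒distinct (IsPerm⇒Distinct {u = v} (proj₁ B)))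
                                 (AscentsAt⇒ascentsAtᵇ p v ascents))) ,
    refl
  fromData : (∃ λ (d : IntervalCode n k) → endpoints d ≡ (v , w)) → IsBooleanInterval n k v w
  fromData (((p , refl) , (v , ok)) , refl) =
    tiling-isBooleanInterval (Distinct⇒IsPerm (AscentPerm⇒Distinct p v ok)) p (AscentPerm⇒AscentsAt p v ok)

card-IntervalCode : ∀ n k → ∃ λ c → Card (IntervalCode n k) c
card-IntervalCode n k =
  let c , size = card-filter (card-× (card-TilingWith n k) (card-Vec card-Fin n))
                          λ ((p , _) , v) → distinct v ∧ ascentsAtᵇ p v
  in c , card-↔ (mk↔ₛ′ (λ (p , v , ok) → (p , v) , ok) (λ ((p , v) , ok) → p , v , ok) (λ _ → refl) (λ _ → refl))
                 size

IntervalCode×Subset↔TilingWith×Perm : (IntervalCode n k × Subset k) ↔ (TilingWith n k × DistinctVec n n)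
IntervalCode×Subset↔TilingWith×Perm {n} {k} =
  ↔-trans (mk↔ₛ′ (λ ((p , a) , s) → p , a , s) (λ (p , a , s) → (p , a) , s) (λ _ → refl) (λ _ → refl))
          (Σ-↔ ↔-refl λ { {p , tw} →
            subst (λ j → (AscentPerm p × Subset j) ↔ DistinctVec n n) tw (AscentPerm×Subset↔Perm p) })

count-IntervalCode : ∀ n k → ∃ λ c → Card (IntervalCode n k) c × 2 ^ k * c ≡ n ! * ((n ∸ k) C k)
count-IntervalCode n k =
  let c , size = card-IntervalCode n k
      c*2^k≡C*n! = card-unique (card-× size (card-Subset k))
                     (card-↔ IntervalCode×Subset↔TilingWith×Perm (card-× (card-TilingWith n k) (card-Perm n)))
  in c , size , trans (NP.*-comm (2 ^ k) c) (trans c*2^k≡C*n! (NP.*-comm ((n ∸ k) C k) (n !)))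

enumerate-image : {A B : Set} {c : ℕ} → Card A c → (e : A → B) → (∀ x y → e x ≡ e y → x ≡ y) →
                  Σ (List B) λ L → Unique L × length L ≡ c × (∀ b → (b ∈ₗ L) ⇔ (∃ λ a → e a ≡ b))
enumerate-image {A} {B} {c} CA e e-injective = L , unique , length≡c , λ b → mk⇔ (listed⇒image b) (image⇒listed b)
  where
  open Inverse CA
  L : List B
  L = List.map (e ∘ from) (allFin c)
  unique : Unique L
  unique = UP.map⁺ (λ {i} {j} eq → trans (sym (strictlyInverseˡ i))
                                    (trans (cong to (e-injective _ _ eq)) (strictlyInverseˡ j)))
                   (UP.allFin⁺ c)
  length≡c : length L ≡ c
  length≡c = trans (LP.length-map _ (allFin c)) (LP.length-tabulate id)
  listed⇒image : ∀ b → b ∈ₗ L → ∃ λ a → e a ≡ b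
  listed⇒image b b∈L with MP.∈-map⁻ (e ∘ from) b∈L
  ... | i , _ , eq = from i , sym eq
  image⇒listed : ∀ b → (∃ λ a → e a ≡ b) → b ∈ₗ L
  image⇒listed b (a , refl) =
    subst (_∈ₗ L) (cong e (strictlyInverseʳ a)) (MP.∈-map⁺ (e ∘ from) (MP.∈-allFin (to a)))

theorem1p3 : (n k : ℕ) → Σ ℕ (λ f → NumBooleanIntervals n k f × 2 ^ k * f ≡ (n !) * ((n ∸ k) C k))
theorem1p3 n k =
  let c , size , count = count-IntervalCode n k
      L , unique , length≡c , listed⇔image = enumerate-image size endpoints endpoints-injective
      listed⇔boolean v w = Eqv.trans (listed⇔image (v , w)) (Eqv.sym (isBooleanInterval⇔endpoints v w))
  in c , (L , unique , length≡c , listed⇔boolean) , count
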